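{- Let $g\ge0$, $n\ge1$ and $\mu_1,\dots,\mu_n\ge1$, with $|\mu|=\mu_1+\cdots+\mu_n$. If $|\mu| < 2g + n$, then $D_{g,n}^t(\mu_1, \ldots, \mu_n) = 0$. If $|\mu| \geq 2g + n$, then $D_{g,n}^t(\mu_1, \ldots, \mu_n) \in \mathbb{Q}[t]$ is a polynomial of degree $|\mu| + 1 - 2g - n$ whose coefficients are symmetric, i.e. $D^t_{g,n}(\mu_1,\dots,\mu_n)=t^{m}D^{1/t}_{g,n}(\mu_1,\dots,\mu_n)$ for some integer $m$.
   Context: A map is a finite graph (loops and multiple edges allowed) embedded in a compact oriented surface so that the complement is a disjoint union of open disks (faces), with faces labelled $1,\dots,n$. A dessin d'enfant is a map whose vertices are coloured black or white so that every edge joins a black vertex and a white vertex; the degree of a face is half the number of edges incident to it. Equivalences/automorphisms are bijections of vertices, edges and faces induced by orientation-preserving homeomorphisms preserving incidences, face labels and colours. $D^t_{g,n}(\mu_1,\dots,\mu_n)$ is the sum, over equivalence classes of connected genus $g$ dessins d'enfant $\Gamma$ with $n$ labelled faces of degrees $\mu_1,\dots,\mu_n$, of $t^{b(\Gamma)}/|\mathrm{Aut}(\Gamma)|$, where $b(\Gamma)$ is the number of black vertices. -}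

module Defs where

open import Data.Bool.Base using (Bool; true; false; _∧_; _∨_; not; if_then_else_)
open import Data.Nat.Base using (ℕ; zero; suc; _+_; _*_; _∸_; _!; _≡ᵇ_; _≤ᵇ_)
open import Data.Nat.Properties using (_!≢0)
open import Data.Fin.Base using (Fin; toℕ)
open import Data.Fin.Properties using (_≟_)
open import Data.List.Base using (List; []; _∷_; [_]; map; concatMap; upTo)
open import Data.Vec.Base using (Vec; []; _∷_; lookup; allFin; toList)
import Data.Vec.Base as Vec
open import Data.Integer.Base using (+_)
open import Data.Rational.Base using (ℚ; _/_)
open import Relation.Nullary.Decidable using (⌊_⌋)

-- A dessin with N edges (edges labelled 0..N-1) is a triple of
-- permutations (σ₀ , σ₁ , σ₂) of Fin N with σ₀ ∘ σ₁ ∘ σ₂ = id generating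
-- a transitive group; black vertices = cycles of σ₀, white vertices =
-- cycles of σ₁, faces = cycles of σ₂ (a face of degree d is a σ₂-cycle
-- of length d).  The face labelling is a map f : edges → Fin n which is
-- constant on σ₂-cycles and whose fibre over i is a single σ₂-cycle of
-- length μᵢ.  By orbit–stabiliser, summing 1/|Aut| over equivalence
-- classes equals (number of such edge-labelled tuples) / N!.

allL : {A : Set} → (A → Bool) → List A → Bool
allL p []       = true
allL p (x ∷ xs) = p x ∧ allL p xs

sumL : List ℕ → ℕ
sumL []       = 0
sumL (x ∷ xs) = x + sumL xs

countL : {A : Set} → (A → Bool) → List A → ℕ
countL p xs = sumL (map (λ x → if p x then 1 else 0) xs)

allVecs : {A : Set} → List A → (k : ℕ) → List (Vec A k)
allVecs xs zero    = [ [] ]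
allVecs xs (suc k) = concatMap (λ x → map (x ∷_) (allVecs xs k)) xs

elems : (N : ℕ) → List (Fin N)
elems N = toList (allFin N)

_==_ : {N : ℕ} → Fin N → Fin N → Bool
x == y = ⌊ x ≟ y ⌋

Endo : ℕ → Set
Endo N = Vec (Fin N) N

app : {N : ℕ} → Endo N → Fin N → Fin N
app σ x = lookup σ x

iter : {N : ℕ} → ℕ → Endo N → Fin N → Fin N
iter zero    σ x = x
iter (suc j) σ x = app σ (iter j σ x)

isPerm : {N : ℕ} → Endo N → Bool
isPerm {N} σ = allL (λ x → allL (λ y → not (app σ x == app σ y) ∨ (x == y)) (elems N)) (elems N)

perms : (N : ℕ) → List (Endo N)
perms N = Data.List.Base.filterᵇ isPerm (allVecs (elems N) N)

-- number of cycles: count the elements that are minimal in their orbit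
cycles : {N : ℕ} → Endo N → ℕ
cycles {N} σ = countL (λ x → allL (λ j → toℕ x ≤ᵇ toℕ (iter j σ x)) (upTo N)) (elems N)

-- transitivity of ⟨σ₀,σ₁⟩ (forward reachability suffices on a finite set)
reach : {N : ℕ} → ℕ → Endo N → Endo N → Fin N → Fin N → Bool
reach zero    σ₀ σ₁ x y = x == y
reach (suc d) σ₀ σ₁ x y = (x == y) ∨ (reach d σ₀ σ₁ (app σ₀ x) y ∨ reach d σ₀ σ₁ (app σ₁ x) y)

transitive : {N : ℕ} → Endo N → Endo N → Bool
transitive {N} σ₀ σ₁ = allL (λ x → allL (λ y → reach N σ₀ σ₁ x y) (elems N)) (elems N)

productIsId : {N : ℕ} → Endo N → Endo N → Endo N → Bool
productIsId {N} σ₀ σ₁ σ₂ = allL (λ x → app σ₀ (app σ₁ (app σ₂ x)) == x) (elems N)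

faceLabelling : {N n : ℕ} → Vec ℕ n → Endo N → Vec (Fin n) N → Bool
faceLabelling {N} {n} μ σ₂ f =
  allL (λ x → lookup f (app σ₂ x) == lookup f x) (elems N)
  ∧ (allL (λ i → countL (λ x → lookup f x == i) (elems N) ≡ᵇ lookup μ i) (elems n)
  ∧ allL (λ x → (iter (lookup μ (lookup f x)) σ₂ x == x)
               ∧ allL (λ j → (j ≡ᵇ 0) ∨ not (iter j σ₂ x == x)) (upTo (lookup μ (lookup f x))))
        (elems N))

size : {n : ℕ} → Vec ℕ n → ℕ
size μ = Vec.sum μ

-- number of edge-labelled connected genus g dessins with n labelled faces
-- of degrees μ and exactly k black vertices
-- (Euler: b + w - |μ| + n = 2 - 2g)
dessinCount : (g n : ℕ) → Vec ℕ n → ℕ → ℕ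
dessinCount g n μ k =
  sumL (map (λ σ₀ → sumL (map (λ σ₁ → sumL (map (λ σ₂ →
    countL (λ f →
        productIsId σ₀ σ₁ σ₂ ∧ (transitive σ₀ σ₁ ∧ (faceLabelling μ σ₂ f
      ∧ ((cycles σ₀ ≡ᵇ k) ∧ (cycles σ₀ + cycles σ₁ + n + 2 * g ≡ᵇ N + 2)))))
      (allVecs (elems n) N))
    (perms N))) (perms N))) (perms N))
  where N = size μ

-- coefficient of t^k in D^t_{g,n}(μ₁,…,μₙ)
Dcoeff : (g n : ℕ) → Vec ℕ n → ℕ → ℚ
Dcoeff g n μ k = _/_ (+ dessinCount g n μ k) (size μ !) {{size μ !≢0}}

-- A dessin with N edges is a triple of permutations (σ₀, σ₁, σ₂) of the edges with σ₀σ₁σ₂ = 1,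
-- ⟨σ₀, σ₁⟩ transitive and σ₂-cycles of lengths μ; the cycles of σ₀ and σ₁ are the b black and w white
-- vertices. Euler's formula b + w = |μ| + 2 − 2g − n together with b, w ≥ 1 leaves only
-- 1 ≤ b ≤ |μ| + 1 − 2g − n, which is empty when |μ| < 2g + n. The involution
-- (σ₀, σ₁, σ₂) ↦ (σ₁⁻¹, σ₀⁻¹, σ₂⁻¹) exchanges black and white vertices, so the coefficients of t^b and
-- t^(m − b) agree, m = b + w. In particular the top coefficient equals the coefficient of t¹, and it is
-- positive: starting from one black and one white vertex joined by n parallel edges, every μ with
-- |μ| ≥ 2g + n is reached by adding white leaves (one edge, one white vertex) and handles (two edges,
-- one genus), all the while keeping a single black vertex.

module Submission where

open import Defs
open import Data.Bool.Base using (Bool; true; false; T; not; _∧_; _∨_; if_then_else_)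
open import Data.Bool.Properties using (T-∧; T-∨; T-≡; T-not-≡)
open import Data.Empty using (⊥-elim)
open import Data.Nat.Base
  using (ℕ; zero; suc; pred; _+_; _*_; _∸_; _≤_; _<_; _≤ᵇ_; _≡ᵇ_; _!; z≤n; s≤s; s≤s⁻¹; >-nonZero)
open import Data.Nat.Properties hiding (_≟_)
open import Data.Nat.DivMod using (_%_; _/_; m≡m%n+[m/n]*n; m%n<n)
open import Data.Nat.Tactic.RingSolver using (solve-∀)
open import Data.Fin.Base using (Fin; zero; suc; toℕ; inject₁; fromℕ)
open import Data.Fin.Properties
  using (_≟_; pigeonhole; any?; toℕ<n; toℕ-injective; toℕ-inject₁; toℕ-fromℕ; fromℕ≢inject₁; inject₁-injective)
open import Data.List.Base using (List; []; _∷_; _++_; map; filterᵇ; applyUpTo; upTo; concatMap)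
open import Data.List.Properties using (map-cong; map-∘; map-++)
open import Data.Vec.Base using (Vec; []; _∷_; lookup; tabulate; toList; allFin; updateAt; replicate)
open import Data.Vec.Properties
  using (≡-dec; lookup∘tabulate; tabulate-cong; tabulate∘lookup; tabulate-∘; toList-map; lookup-replicate;
         lookup∘updateAt; lookup∘updateAt′; updateAt-updateAt-local; updateAt-id)
import Data.Integer.Base as ℤ
open import Data.Rational.Base using (ℚ; 0ℚ; Positive)
import Data.Rational.Base as ℚ
open import Data.Rational.Properties using (0/n≡0; normalize-pos)
open import Data.Product.Base using (∃; ∃-syntax; _×_; _,_; proj₁; proj₂)
open import Data.Sum.Base using (_⊎_; inj₁; inj₂)
open import Data.Unit.Base using (tt)
open import Function.Base using (_∘_; id)
open import Function.Bundles using (Equivalence)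
open import Function.Definitions using (Injective)
open import Relation.Binary.Definitions using (DecidableEquality)
open import Relation.Binary.PropositionalEquality
open import Relation.Nullary using (¬_)
open import Relation.Nullary.Decidable
  using (⌊_⌋; yes; no; toWitness; fromWitness; isYes≗does; ⌊⌋-map′; _×-dec_; dec-true; dec-false)

private variable
  A B : Set
  N n w : ℕ

-- Boolean reflection and sums over enumerations

T-∧-intro : ∀ {a b} → T a → T b → T (a ∧ b)
T-∧-intro ta tb = Equivalence.from T-∧ (ta , tb)

T-∧-elim : ∀ {a b} → T (a ∧ b) → T a × T b
T-∧-elim = Equivalence.to T-∧

T-∨-introˡ : ∀ {a} b → T a → T (a ∨ b)
T-∨-introˡ b ta = Equivalence.from T-∨ (inj₁ ta)

T-∨-introʳ : ∀ a {b} → T b → T (a ∨ b)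
T-∨-introʳ a tb = Equivalence.from T-∨ (inj₂ tb)

T-∨-elim : ∀ a {b} → T (a ∨ b) → T a ⊎ T b
T-∨-elim a = Equivalence.to T-∨

T-ext : ∀ {a b} → (T a → T b) → (T b → T a) → a ≡ b
T-ext {false} {false} _   _   = refl
T-ext {false} {true}  _   b⇒a = ⊥-elim (b⇒a tt)
T-ext {true}  {false} a⇒b _   = ⊥-elim (a⇒b tt)
T-ext {true}  {true}  _   _   = refl

==⇒≡ : {x y : Fin N} → T (x == y) → x ≡ y
==⇒≡ {x = x} {y} = toWitness {a? = x ≟ y}

≡⇒== : {x y : Fin N} → x ≡ y → T (x == y)
≡⇒== {x = x} {y} = fromWitness {a? = x ≟ y}

==-true : {x y : Fin N} → x ≡ y → (x == y) ≡ true
==-true {x = x} {y} eq = trans (isYes≗does (x ≟ y)) (dec-true (x ≟ y) eq)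

==-false : {x y : Fin N} → x ≢ y → (x == y) ≡ false
==-false {x = x} {y} x≢y = trans (isYes≗does (x ≟ y)) (dec-false (x ≟ y) x≢y)

allL-tabulate⁻ : ∀ {p : A → Bool} (f : Fin N → A) →
  T (allL p (toList (tabulate f))) → ∀ i → T (p (f i))
allL-tabulate⁻ {N = suc N} f h zero    = proj₁ (T-∧-elim h)
allL-tabulate⁻ {N = suc N} f h (suc i) = allL-tabulate⁻ (f ∘ suc) (proj₂ (T-∧-elim h)) i

allL-tabulate⁺ : ∀ {p : A → Bool} (f : Fin N → A) →
  (∀ i → T (p (f i))) → T (allL p (toList (tabulate f)))
allL-tabulate⁺ {N = zero}  f h = tt
allL-tabulate⁺ {N = suc N} f h = T-∧-intro (h zero) (allL-tabulate⁺ (f ∘ suc) (h ∘ suc))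

allL-elems⁻ : ∀ {p : Fin N → Bool} → T (allL p (elems N)) → ∀ x → T (p x)
allL-elems⁻ = allL-tabulate⁻ id

allL-elems⁺ : ∀ {p : Fin N → Bool} → (∀ x → T (p x)) → T (allL p (elems N))
allL-elems⁺ = allL-tabulate⁺ id

allL-applyUpTo⁻ : ∀ {p : ℕ → Bool} (f : ℕ → ℕ) n →
  T (allL p (applyUpTo f n)) → ∀ j → j < n → T (p (f j))
allL-applyUpTo⁻ f (suc n) h zero    _         = proj₁ (T-∧-elim h)
allL-applyUpTo⁻ f (suc n) h (suc j) (s≤s j<n) = allL-applyUpTo⁻ (f ∘ suc) n (proj₂ (T-∧-elim h)) j j<n

allL-applyUpTo⁺ : ∀ {p : ℕ → Bool} (f : ℕ → ℕ) n →
  (∀ j → j < n → T (p (f j))) → T (allL p (applyUpTo f n))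
allL-applyUpTo⁺ f zero    h = tt
allL-applyUpTo⁺ f (suc n) h =
  T-∧-intro (h zero (s≤s z≤n)) (allL-applyUpTo⁺ (f ∘ suc) n (λ j j<n → h (suc j) (s≤s j<n)))

allL-cong : ∀ {p q : A → Bool} → (∀ x → p x ≡ q x) → ∀ xs → allL p xs ≡ allL q xs
allL-cong p≗q []       = refl
allL-cong p≗q (x ∷ xs) = cong₂ _∧_ (p≗q x) (allL-cong p≗q xs)

iverson : Bool → ℕ → ℕ
iverson b c = if b then c else 0

sumL-cong : ∀ {F G : A → ℕ} → (∀ x → F x ≡ G x) → ∀ xs → sumL (map F xs) ≡ sumL (map G xs)
sumL-cong F≗G xs = cong sumL (map-cong F≗G xs)

countL-cong : ∀ {p q : A → Bool} → (∀ x → p x ≡ q x) → ∀ xs → countL p xs ≡ countL q xs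
countL-cong p≗q = sumL-cong (λ x → cong (λ b → iverson b 1) (p≗q x))

sumL-zero : ∀ {F : A → ℕ} → (∀ x → F x ≡ 0) → ∀ xs → sumL (map F xs) ≡ 0
sumL-zero F≗0 []       = refl
sumL-zero F≗0 (x ∷ xs) = cong₂ _+_ (F≗0 x) (sumL-zero F≗0 xs)

sumL-mono-≤ : ∀ {F G : A → ℕ} → (∀ x → F x ≤ G x) → ∀ xs → sumL (map F xs) ≤ sumL (map G xs)
sumL-mono-≤ F≤G []       = z≤n
sumL-mono-≤ F≤G (x ∷ xs) = +-mono-≤ (F≤G x) (sumL-mono-≤ F≤G xs)

sumL-+ : (F G : A → ℕ) → ∀ xs → sumL (map (λ x → F x + G x) xs) ≡ sumL (map F xs) + sumL (map G xs)
sumL-+ F G []       = refl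
sumL-+ F G (x ∷ xs) = trans (cong (F x + G x +_) (sumL-+ F G xs)) (interchange (F x) (G x) _ _)
  where
  interchange : ∀ a b c d → a + b + (c + d) ≡ a + c + (b + d)
  interchange = solve-∀

sumL-swap : (G : A → B → ℕ) → ∀ xs ys →
  sumL (map (λ x → sumL (map (G x) ys)) xs) ≡ sumL (map (λ y → sumL (map (λ x → G x y) xs)) ys)
sumL-swap G []       ys = sym (sumL-zero (λ _ → refl) ys)
sumL-swap G (x ∷ xs) ys =
  trans (cong (sumL (map (G x) ys) +_) (sumL-swap G xs ys)) (sym (sumL-+ (G x) _ ys))

iverson-sumL : ∀ b (F : A → ℕ) xs → iverson b (sumL (map F xs)) ≡ sumL (map (iverson b ∘ F) xs)
iverson-sumL true  F xs = refl
iverson-sumL false F xs = sym (sumL-zero (λ _ → refl) xs)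

iverson-∧ : ∀ a b c → iverson a (iverson b c) ≡ iverson (a ∧ b) c
iverson-∧ true  b c = refl
iverson-∧ false b c = refl

sumL-iverson : (p : A → Bool) (c : ℕ) → ∀ xs → sumL (map (λ x → iverson (p x) c) xs) ≡ c * countL p xs
sumL-iverson p c []       = sym (*-zeroʳ c)
sumL-iverson p c (x ∷ xs) with p x
... | true  = trans (cong (c +_) (sumL-iverson p c xs)) (sym (*-suc c _))
... | false = sumL-iverson p c xs

sumL-filterᵇ : (p : A → Bool) (F : A → ℕ) → ∀ xs →
  sumL (map F (filterᵇ p xs)) ≡ sumL (map (λ x → iverson (p x) (F x)) xs)
sumL-filterᵇ p F []       = refl
sumL-filterᵇ p F (x ∷ xs) with p x
... | true  = cong (F x +_) (sumL-filterᵇ p F xs)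
... | false = sumL-filterᵇ p F xs

sumL-filterᵇ-cong : ∀ (p : A → Bool) {F G : A → ℕ} → (∀ x → T (p x) → F x ≡ G x) → ∀ xs →
  sumL (map F (filterᵇ p xs)) ≡ sumL (map G (filterᵇ p xs))
sumL-filterᵇ-cong p F≗G []       = refl
sumL-filterᵇ-cong p F≗G (x ∷ xs) with p x in px
... | true  = cong₂ _+_ (F≗G x (subst T (sym px) tt)) (sumL-filterᵇ-cong p F≗G xs)
... | false = sumL-filterᵇ-cong p F≗G xs

sumL-++ : ∀ xs ys → sumL (xs ++ ys) ≡ sumL xs + sumL ys
sumL-++ []       ys = refl
sumL-++ (x ∷ xs) ys = trans (cong (x +_) (sumL-++ xs ys)) (sym (+-assoc x _ _))

countL-map : (p : B → Bool) (f : A → B) → ∀ xs → countL p (map f xs) ≡ countL (p ∘ f) xs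
countL-map p f xs = cong sumL (sym (map-∘ xs))

countL-concatMap : (p : B → Bool) (f : A → List B) → ∀ xs →
  countL p (concatMap f xs) ≡ sumL (map (countL p ∘ f) xs)
countL-concatMap p f []       = refl
countL-concatMap p f (x ∷ xs) = begin
  sumL (map _ (f x ++ concatMap f xs))              ≡⟨ cong sumL (map-++ _ (f x) (concatMap f xs)) ⟩
  sumL (map _ (f x) ++ map _ (concatMap f xs))      ≡⟨ sumL-++ (map _ (f x)) _ ⟩
  countL p (f x) + countL p (concatMap f xs)        ≡⟨ cong (countL p (f x) +_) (countL-concatMap p f xs) ⟩
  countL p (f x) + sumL (map (countL p ∘ f) xs)     ∎
  where open ≡-Reasoning

countL-∧ : ∀ b (p : A → Bool) xs → countL (λ x → b ∧ p x) xs ≡ iverson b (countL p xs)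
countL-∧ true  p xs = refl
countL-∧ false p xs = sumL-zero (λ _ → refl) xs

record Enumerates (_≟ᴬ_ : DecidableEquality A) (xs : List A) : Set where
  field
    occurs-once : ∀ v → countL (λ u → ⌊ u ≟ᴬ v ⌋) xs ≡ 1
open Enumerates

elems-suc : ∀ N → elems (suc N) ≡ zero ∷ map suc (elems N)
elems-suc N = cong (zero ∷_) (trans (cong toList (tabulate-∘ suc id)) (toList-map suc (allFin N)))

sumL-elems-suc : (F : Fin (suc N) → ℕ) → sumL (map F (elems (suc N))) ≡ F zero + sumL (map (F ∘ suc) (elems N))
sumL-elems-suc {N} F = trans (cong (sumL ∘ map F) (elems-suc N)) (cong (λ xs → F zero + sumL xs) (sym (map-∘ (elems N))))

enumerates-elems : ∀ N → Enumerates _≟_ (elems N)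
occurs-once (enumerates-elems (suc N)) v = trans (cong (countL (λ u → ⌊ u ≟ v ⌋)) (elems-suc N)) (count v)
  where
  count : (w : Fin (suc N)) → countL (λ u → ⌊ u ≟ w ⌋) (zero ∷ map suc (elems N)) ≡ 1
  count zero    = cong suc (trans (countL-map _ suc (elems N)) (sumL-zero (λ _ → refl) (elems N)))
  count (suc w) = trans (countL-map _ suc (elems N))
    (trans (countL-cong (λ u → ⌊⌋-map′ _ _ (u ≟ w)) (elems N)) (occurs-once (enumerates-elems N) w))

enumerates-allVecs : ∀ {xs : List (Fin N)} → Enumerates _≟_ xs →
  ∀ k → Enumerates (≡-dec _≟_) (allVecs xs k)
occurs-once (enumerates-allVecs enum zero)    []       = refl
occurs-once (enumerates-allVecs {xs = xs} enum (suc k)) (v ∷ vs) = begin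
  countL _ (concatMap (λ x → map (x ∷_) (allVecs xs k)) xs)   ≡⟨ countL-concatMap _ (λ x → map (x ∷_) (allVecs xs k)) xs ⟩
  sumL (map (λ x → countL _ (map (x ∷_) (allVecs xs k))) xs)  ≡⟨ sumL-cong head-matches xs ⟩
  countL (λ x → ⌊ x ≟ v ⌋) xs                                 ≡⟨ occurs-once enum v ⟩
  1                                                           ∎
  where
  open ≡-Reasoning
  ⌊∷≟∷⌋ : ∀ x u → ⌊ ≡-dec _≟_ (x ∷ u) (v ∷ vs) ⌋ ≡ ⌊ x ≟ v ⌋ ∧ ⌊ ≡-dec _≟_ u vs ⌋
  ⌊∷≟∷⌋ x u = trans (⌊⌋-map′ _ _ (x ≟ v ×-dec ≡-dec _≟_ u vs))
    (trans (isYes≗does (x ≟ v ×-dec _)) (sym (cong₂ _∧_ (isYes≗does (x ≟ v)) (isYes≗does (≡-dec _≟_ u vs)))))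
  head-matches : ∀ x → countL (λ u → ⌊ ≡-dec _≟_ u (v ∷ vs) ⌋) (map (x ∷_) (allVecs xs k)) ≡ iverson ⌊ x ≟ v ⌋ 1
  head-matches x = begin
    countL _ (map (x ∷_) (allVecs xs k))                        ≡⟨ countL-map _ (x ∷_) (allVecs xs k) ⟩
    countL (λ u → ⌊ ≡-dec _≟_ (x ∷ u) (v ∷ vs) ⌋) (allVecs xs k) ≡⟨ countL-cong (λ u → ⌊∷≟∷⌋ x u) (allVecs xs k) ⟩
    countL (λ u → ⌊ x ≟ v ⌋ ∧ ⌊ ≡-dec _≟_ u vs ⌋) (allVecs xs k) ≡⟨ countL-∧ ⌊ x ≟ v ⌋ _ (allVecs xs k) ⟩
    iverson ⌊ x ≟ v ⌋ (countL _ (allVecs xs k))                 ≡⟨ cong (iverson ⌊ x ≟ v ⌋) (occurs-once (enumerates-allVecs enum k) vs) ⟩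
    iverson ⌊ x ≟ v ⌋ 1                                         ∎

module _ {_≟ᴬ_ : DecidableEquality A} {xs : List A} (enum : Enumerates _≟ᴬ_ xs) where

  sumL-pick : (F : A → ℕ) (z : A) → sumL (map (λ y → iverson ⌊ y ≟ᴬ z ⌋ (F y)) xs) ≡ F z
  sumL-pick F z = begin
    sumL (map (λ y → iverson ⌊ y ≟ᴬ z ⌋ (F y)) xs)  ≡⟨ sumL-cong at-z xs ⟩
    sumL (map (λ y → iverson ⌊ y ≟ᴬ z ⌋ (F z)) xs)  ≡⟨ sumL-iverson _ (F z) xs ⟩
    F z * countL (λ y → ⌊ y ≟ᴬ z ⌋) xs              ≡⟨ cong (F z *_) (occurs-once enum z) ⟩
    F z * 1                                        ≡⟨ *-identityʳ (F z) ⟩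
    F z                                            ∎
    where
    open ≡-Reasoning
    at-z : ∀ y → iverson ⌊ y ≟ᴬ z ⌋ (F y) ≡ iverson ⌊ y ≟ᴬ z ⌋ (F z)
    at-z y with y ≟ᴬ z
    ... | yes refl = refl
    ... | no  _    = refl

  ≤-sumL : (F : A → ℕ) (z : A) → F z ≤ sumL (map F xs)
  ≤-sumL F z = begin
    F z                                              ≡⟨ sumL-pick F z ⟨
    sumL (map (λ y → iverson ⌊ y ≟ᴬ z ⌋ (F y)) xs)  ≤⟨ sumL-mono-≤ (λ y → iverson≤ ⌊ y ≟ᴬ z ⌋ (F y)) xs ⟩
    sumL (map F xs)                                  ∎
    where
    open ≤-Reasoning
    iverson≤ : ∀ b c → iverson b c ≤ c
    iverson≤ true  c = ≤-refl
    iverson≤ false c = z≤n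

  ≤-sumL-filterᵇ : (p : A → Bool) (F : A → ℕ) {z : A} → T (p z) → F z ≤ sumL (map F (filterᵇ p xs))
  ≤-sumL-filterᵇ p F {z} pz with p z | ≤-sumL (λ y → iverson (p y) (F y)) z
  ... | true | Fz≤ = subst (F z ≤_) (sym (sumL-filterᵇ p F xs)) Fz≤

  sumL-filterᵇ-involution : (p : A → Bool) {h : A → A} →
    (∀ {x} → T (p x) → T (p (h x))) → (∀ {x} → T (p x) → h (h x) ≡ x) →
    (F : A → ℕ) → sumL (map (F ∘ h) (filterᵇ p xs)) ≡ sumL (map F (filterᵇ p xs))
  -- Double counting: p x ∧ y ≡ h x holds exactly when p y ∧ x ≡ h y, as h is an involution on p.
  sumL-filterᵇ-involution p {h} preserves involutive F = begin
    sumL (map (F ∘ h) (filterᵇ p xs))                                  ≡⟨ sumL-filterᵇ p (F ∘ h) xs ⟩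
    sumL (map (λ x → iverson (p x) (F (h x))) xs)                      ≡⟨ sumL-cong expand xs ⟩
    sumL (map (λ x → sumL (map (λ y → iverson (p x ∧ ⌊ y ≟ᴬ h x ⌋) (F y)) xs)) xs)
      ≡⟨ sumL-swap (λ x y → iverson (p x ∧ ⌊ y ≟ᴬ h x ⌋) (F y)) xs xs ⟩
    sumL (map (λ y → sumL (map (λ x → iverson (p x ∧ ⌊ y ≟ᴬ h x ⌋) (F y)) xs)) xs)
      ≡⟨ sumL-cong collapse xs ⟩
    sumL (map (λ y → iverson (p y) (F y)) xs)                          ≡⟨ sumL-filterᵇ p F xs ⟨
    sumL (map F (filterᵇ p xs))                                        ∎
    where
    open ≡-Reasoning
    paired : ∀ x y → T (p x ∧ ⌊ y ≟ᴬ h x ⌋) → T (p y ∧ ⌊ x ≟ᴬ h y ⌋)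
    paired x y t with T-∧-elim t
    ... | px , y≡hx with refl ← toWitness {a? = y ≟ᴬ h x} y≡hx =
      T-∧-intro (preserves px) (fromWitness {a? = x ≟ᴬ h (h x)} (sym (involutive px)))
    expand : ∀ x → iverson (p x) (F (h x)) ≡ sumL (map (λ y → iverson (p x ∧ ⌊ y ≟ᴬ h x ⌋) (F y)) xs)
    expand x = begin
      iverson (p x) (F (h x))                                             ≡⟨ cong (iverson (p x)) (sumL-pick F (h x)) ⟨
      iverson (p x) (sumL (map (λ y → iverson ⌊ y ≟ᴬ h x ⌋ (F y)) xs))   ≡⟨ iverson-sumL (p x) _ xs ⟩
      sumL (map (λ y → iverson (p x) (iverson ⌊ y ≟ᴬ h x ⌋ (F y))) xs)   ≡⟨ sumL-cong (λ y → iverson-∧ (p x) _ (F y)) xs ⟩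
      sumL (map (λ y → iverson (p x ∧ ⌊ y ≟ᴬ h x ⌋) (F y)) xs)           ∎
    collapse : ∀ y → sumL (map (λ x → iverson (p x ∧ ⌊ y ≟ᴬ h x ⌋) (F y)) xs) ≡ iverson (p y) (F y)
    collapse y = begin
      sumL (map (λ x → iverson (p x ∧ ⌊ y ≟ᴬ h x ⌋) (F y)) xs)
        ≡⟨ sumL-cong (λ x → cong (λ b → iverson b (F y)) (T-ext (paired x y) (paired y x))) xs ⟩
      sumL (map (λ x → iverson (p y ∧ ⌊ x ≟ᴬ h y ⌋) (F y)) xs)          ≡⟨ sumL-cong (λ x → iverson-∧ (p y) _ (F y)) xs ⟨
      sumL (map (λ x → iverson (p y) (iverson ⌊ x ≟ᴬ h y ⌋ (F y))) xs)  ≡⟨ iverson-sumL (p y) _ xs ⟨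
      iverson (p y) (sumL (map (λ x → iverson ⌊ x ≟ᴬ h y ⌋ (F y)) xs))  ≡⟨ cong (iverson (p y)) (sumL-pick (λ _ → F y) (h y)) ⟩
      iverson (p y) (F y)                                                ∎

-- Orbits and cycle counts of injective maps of Fin N

iterate : ℕ → (A → A) → A → A
iterate zero    s x = x
iterate (suc j) s x = s (iterate j s x)

iter≡iterate : ∀ j (σ : Endo N) x → iter j σ x ≡ iterate j (app σ) x
iter≡iterate zero    σ x = refl
iter≡iterate (suc j) σ x = cong (app σ) (iter≡iterate j σ x)

iterate-+ : ∀ i j (s : A → A) x → iterate (i + j) s x ≡ iterate i s (iterate j s x)
iterate-+ zero    j s x = refl
iterate-+ (suc i) j s x = cong s (iterate-+ i j s x)

iterate-suc : ∀ j (s : A → A) x → iterate (suc j) s x ≡ iterate j s (s x)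
iterate-suc j s x = trans (cong (λ k → iterate k s x) (+-comm 1 j)) (iterate-+ j 1 s x)

iterate-comm : ∀ i j (s : A → A) x → iterate i s (iterate j s x) ≡ iterate j s (iterate i s x)
iterate-comm i j s x =
  trans (sym (iterate-+ i j s x)) (trans (cong (λ k → iterate k s x) (+-comm i j)) (iterate-+ j i s x))

iterate-cong : ∀ {s t : A → A} → (∀ x → s x ≡ t x) → ∀ j x → iterate j s x ≡ iterate j t x
iterate-cong s≗t zero    x = refl
iterate-cong {t = t} s≗t (suc j) x = trans (s≗t _) (cong t (iterate-cong s≗t j x))

iterate-injective : ∀ {s : A → A} → Injective _≡_ _≡_ s → ∀ j → Injective _≡_ _≡_ (iterate j s)
iterate-injective s-inj zero    eq = eq
iterate-injective s-inj (suc j) eq = iterate-injective s-inj j (s-inj eq)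

iterate-retraction : ∀ {s t : A → A} → (∀ x → t (s x) ≡ x) → ∀ j x → iterate j t (iterate j s x) ≡ x
iterate-retraction ts≗id zero    x = refl
iterate-retraction {s = s} {t} ts≗id (suc j) x = begin
  iterate (suc j) t (s (iterate j s x))  ≡⟨ iterate-suc j t _ ⟩
  iterate j t (t (s (iterate j s x)))    ≡⟨ cong (iterate j t) (ts≗id _) ⟩
  iterate j t (iterate j s x)            ≡⟨ iterate-retraction ts≗id j x ⟩
  x                                      ∎
  where open ≡-Reasoning

iterate-*-period : ∀ {s : A → A} {x} P → iterate P s x ≡ x → ∀ q → iterate (q * P) s x ≡ x
iterate-*-period P periodic zero    = refl
iterate-*-period {s = s} {x} P periodic (suc q) =
  trans (iterate-+ P (q * P) s x) (trans (cong (iterate P s) (iterate-*-period P periodic q)) periodic)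

iterate-% : ∀ {s : A → A} {x} P → iterate (suc P) s x ≡ x → ∀ j → iterate j s x ≡ iterate (j % suc P) s x
iterate-% {s = s} {x} P periodic j = begin
  iterate j s x                                                ≡⟨ cong (λ k → iterate k s x) (m≡m%n+[m/n]*n j (suc P)) ⟩
  iterate (j % suc P + j / suc P * suc P) s x                  ≡⟨ iterate-+ (j % suc P) _ s x ⟩
  iterate (j % suc P) s (iterate (j / suc P * suc P) s x)      ≡⟨ cong (iterate (j % suc P) s) (iterate-*-period (suc P) periodic (j / suc P)) ⟩
  iterate (j % suc P) s x                                      ∎
  where open ≡-Reasoning

retraction⇒injective : ∀ {B : Set} {s : A → B} {t : B → A} → (∀ x → t (s x) ≡ x) → Injective _≡_ _≡_ s
retraction⇒injective {s = s} {t} ts≗id {x} {y} sx≡sy = trans (sym (ts≗id x)) (trans (cong t sx≡sy) (ts≗id y))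

InOrbit : (A → A) → A → A → Set
InOrbit s x y = ∃[ j ] iterate j s x ≡ y

InOrbit-step : ∀ {s : A → A} {x y} → InOrbit s x y → InOrbit s x (s y)
InOrbit-step (j , refl) = suc j , refl

InOrbit-trans : ∀ {s : A → A} {x y z} → InOrbit s x y → InOrbit s y z → InOrbit s x z
InOrbit-trans {s = s} {x} (i , refl) (j , refl) = j + i , iterate-+ j i s x

SingleOrbit : (A → A) → Set
SingleOrbit s = ∀ x y → InOrbit s x y

inverse : (Fin N → Fin N) → Fin N → Fin N
inverse s y with any? (λ x → s x ≟ y)
... | yes (x , _) = x
... | no  _       = y

module _ {s : Fin N → Fin N} (s-inj : Injective _≡_ _≡_ s) where

  -- Two of the N + 1 points x, s x, …, s^N x coincide, and s is injective.
  period : ∀ x → ∃[ P ] suc P ≤ N × iterate (suc P) s x ≡ x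
  period x with i , j , i<j , sⁱx≡sʲx ← pigeonhole (n<1+n N) (λ i → iterate (toℕ i) s x) =
    pred d , subst (_≤ N) (sym suc-pred-d) d≤N , subst (λ k → iterate k s x ≡ x) (sym suc-pred-d) sᵈx≡x
    where
    d : ℕ
    d = toℕ j ∸ toℕ i
    suc-pred-d : suc (pred d) ≡ d
    suc-pred-d = suc-pred d {{>-nonZero (m<n⇒0<n∸m i<j)}}
    d≤N : d ≤ N
    d≤N = ≤-trans (m∸n≤m (toℕ j) (toℕ i)) (s≤s⁻¹ (toℕ<n j))
    sᵈx≡x : iterate d s x ≡ x
    sᵈx≡x = iterate-injective s-inj (toℕ i) (begin
      iterate (toℕ i) s (iterate d s x)  ≡⟨ iterate-+ (toℕ i) d s x ⟨
      iterate (toℕ i + d) s x            ≡⟨ cong (λ k → iterate k s x) (m+[n∸m]≡n (<⇒≤ i<j)) ⟩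
      iterate (toℕ j) s x                ≡⟨ sⁱx≡sʲx ⟨
      iterate (toℕ i) s x                ∎)
      where open ≡-Reasoning

  iterate-below : ∀ x j → ∃[ j′ ] j′ < N × iterate j s x ≡ iterate j′ s x
  iterate-below x j with P , P<N , periodic ← period x =
    j % suc P , ≤-trans (m%n<n j (suc P)) P<N , iterate-% P periodic j

  inverseʳ : ∀ y → s (inverse s y) ≡ y
  inverseʳ y with any? (λ x → s x ≟ y)
  ... | yes (x , sx≡y) = sx≡y
  ... | no  ∄x with P , _ , periodic ← period y = ⊥-elim (∄x (iterate P s y , periodic))

  inverseˡ : ∀ x → inverse s (s x) ≡ x
  inverseˡ x = s-inj (inverseʳ (s x))

  inverse-injective : Injective _≡_ _≡_ (inverse s)
  inverse-injective = retraction⇒injective {t = s} inverseʳ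

  InOrbit-retraction : ∀ {t : Fin N → Fin N} → (∀ x → t (s x) ≡ x) → ∀ {x y} → InOrbit t x y → InOrbit s x y
  -- The orbit of x has period P + 1, and on it the retraction t acts as s^P; hence tʲ x = s^(jP) x.
  InOrbit-retraction {t} ts≗id {x} (j , refl) with P , _ , periodic ← period x = j * P , sym (go j)
    where
    step : ∀ k → t (iterate k s x) ≡ iterate (k + P) s x
    step k = begin
      t (iterate k s x)                          ≡⟨ cong (t ∘ iterate k s) periodic ⟨
      t (iterate k s (iterate (suc P) s x))      ≡⟨ cong t (iterate-+ k (suc P) s x) ⟨
      t (iterate (k + suc P) s x)                ≡⟨ cong (λ m → t (iterate m s x)) (+-suc k P) ⟩
      t (s (iterate (k + P) s x))                ≡⟨ ts≗id _ ⟩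
      iterate (k + P) s x                        ∎
      where open ≡-Reasoning
    go : ∀ j → iterate j t x ≡ iterate (j * P) s x
    go zero    = refl
    go (suc j) = trans (cong t (go j)) (trans (step (j * P)) (cong (λ m → iterate m s x) (+-comm (j * P) P)))

IsOrbitMin : (Fin N → Fin N) → Fin N → Set
IsOrbitMin s x = ∀ {y} → InOrbit s x y → toℕ x ≤ toℕ y

orbitMinᵇ : (Fin N → Fin N) → Fin N → Bool
orbitMinᵇ {N} s x = allL (λ j → toℕ x ≤ᵇ toℕ (iterate j s x)) (upTo N)

cycleCount : (Fin N → Fin N) → ℕ
cycleCount {N} s = countL (orbitMinᵇ s) (elems N)

cycles≡cycleCount : (σ : Endo N) → cycles σ ≡ cycleCount (app σ)
cycles≡cycleCount {N} σ =
  countL-cong (λ x → allL-cong (λ j → cong (λ y → toℕ x ≤ᵇ toℕ y) (iter≡iterate j σ x)) (upTo N)) (elems N)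

orbitMinᵇ⁺ : ∀ {s : Fin N → Fin N} {x} → IsOrbitMin s x → T (orbitMinᵇ s x)
orbitMinᵇ⁺ {N} x-min = allL-applyUpTo⁺ (λ j → j) N (λ j _ → ≤⇒≤ᵇ (x-min (j , refl)))

-- Only the first N iterates are inspected; this suffices because every orbit closes within N steps.
orbitMinᵇ⁻ : ∀ {s : Fin N → Fin N} → Injective _≡_ _≡_ s → ∀ {x} → T (orbitMinᵇ s x) → IsOrbitMin s x
orbitMinᵇ⁻ {N} {s} s-inj {x} t (j , refl) with j′ , j′<N , sʲx≡sʲ′x ← iterate-below s-inj x j =
  subst (λ y → toℕ x ≤ toℕ y) (sym sʲx≡sʲ′x) (≤ᵇ⇒≤ _ _ (allL-applyUpTo⁻ (λ j → j) N t j′ j′<N))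

orbitMinᵇ-≡ : ∀ {M} {s : Fin M → Fin M} {t : Fin N → Fin N} {x y} → Injective _≡_ _≡_ s → Injective _≡_ _≡_ t →
  (IsOrbitMin s x → IsOrbitMin t y) → (IsOrbitMin t y → IsOrbitMin s x) → orbitMinᵇ s x ≡ orbitMinᵇ t y
orbitMinᵇ-≡ s-inj t-inj ⇒ ⇐ = T-ext (orbitMinᵇ⁺ ∘ ⇒ ∘ orbitMinᵇ⁻ s-inj) (orbitMinᵇ⁺ ∘ ⇐ ∘ orbitMinᵇ⁻ t-inj)

cycleCount-cong : ∀ {s t : Fin N → Fin N} → (∀ x → s x ≡ t x) → cycleCount s ≡ cycleCount t
cycleCount-cong {N} s≗t =
  countL-cong (λ x → allL-cong (λ j → cong (λ y → toℕ x ≤ᵇ toℕ y) (iterate-cong s≗t j x)) (upTo N)) (elems N)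

cycleCount-inverse : ∀ {s : Fin N → Fin N} → Injective _≡_ _≡_ s → cycleCount (inverse s) ≡ cycleCount s
cycleCount-inverse {N} {s} s-inj = countL-cong (λ x → orbitMinᵇ-≡ {x = x} (inverse-injective s-inj) s-inj
    (λ x-min → x-min ∘ InOrbit-retraction (inverse-injective s-inj) {t = s} (inverseʳ s-inj))
    (λ x-min → x-min ∘ InOrbit-retraction s-inj {t = inverse s} (inverseˡ s-inj)))
  (elems N)

zero-isOrbitMin : (s : Fin (suc N) → Fin (suc N)) → IsOrbitMin s zero
zero-isOrbitMin s _ = z≤n

1≤cycleCount : 1 ≤ N → (s : Fin N → Fin N) → 1 ≤ cycleCount s
1≤cycleCount {suc N} _ s with orbitMinᵇ s zero | orbitMinᵇ⁺ {s = s} (zero-isOrbitMin s)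
... | true | _ = s≤s z≤n

-- Every point other than zero has zero in its orbit, so it is not an orbit minimum.
cycleCount-singleOrbit : 1 ≤ N → ∀ {s : Fin N → Fin N} → Injective _≡_ _≡_ s → SingleOrbit s → cycleCount s ≡ 1
cycleCount-singleOrbit {suc N} _ {s} s-inj single = trans (cong (countL (orbitMinᵇ s)) (elems-suc N)) count
  where
  not-min : ∀ i → iverson (orbitMinᵇ s (suc i)) 1 ≡ 0
  not-min i with orbitMinᵇ s (suc i) in eq
  ... | false = refl
  ... | true with j , sʲi≡0 ← single (suc i) zero
    with () ← orbitMinᵇ⁻ s-inj (subst T (sym eq) _) (j , sʲi≡0)
  count : countL (orbitMinᵇ s) (zero ∷ map suc (elems N)) ≡ 1
  count with orbitMinᵇ s zero | orbitMinᵇ⁺ {s = s} (zero-isOrbitMin s)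
  ... | true | _ = cong suc (trans (countL-map (orbitMinᵇ s) suc (elems N)) (sumL-zero not-min (elems N)))

-- Permutations as vectors and the black–white duality

isPerm⁻ : (σ : Endo N) → T (isPerm σ) → Injective _≡_ _≡_ (app σ)
isPerm⁻ σ t {x} {y} σx≡σy with T-∨-elim (not (app σ x == app σ y)) (allL-elems⁻ (allL-elems⁻ t x) y)
... | inj₁ σx≢σy = ⊥-elim (subst (T ∘ not) (==-true σx≡σy) σx≢σy)
... | inj₂ x==y  = ==⇒≡ x==y

isPerm⁺ : (σ : Endo N) → Injective _≡_ _≡_ (app σ) → T (isPerm σ)
isPerm⁺ σ σ-inj = allL-elems⁺ λ x → allL-elems⁺ λ y → ⇒-as-∨ x y
  where
  ⇒-as-∨ : ∀ x y → T (not (app σ x == app σ y) ∨ (x == y))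
  ⇒-as-∨ x y with app σ x == app σ y in eq
  ... | true  = T-∨-introʳ false (≡⇒== (σ-inj (==⇒≡ (subst T (sym eq) _))))
  ... | false = _

_⁻¹ : Endo N → Endo N
σ ⁻¹ = tabulate (inverse (app σ))

module _ (σ : Endo N) (σ-inj : Injective _≡_ _≡_ (app σ)) where

  ⁻¹-inverseʳ : ∀ y → app σ (app (σ ⁻¹) y) ≡ y
  ⁻¹-inverseʳ y = trans (cong (app σ) (lookup∘tabulate (inverse (app σ)) y)) (inverseʳ σ-inj y)

  ⁻¹-inverseˡ : ∀ x → app (σ ⁻¹) (app σ x) ≡ x
  ⁻¹-inverseˡ x = trans (lookup∘tabulate (inverse (app σ)) (app σ x)) (inverseˡ σ-inj x)

  ⁻¹-injective : Injective _≡_ _≡_ (app (σ ⁻¹))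
  ⁻¹-injective {x} {y} eq = trans (sym (⁻¹-inverseʳ x)) (trans (cong (app σ) eq) (⁻¹-inverseʳ y))

  ⁻¹-involutive : (σ ⁻¹) ⁻¹ ≡ σ
  ⁻¹-involutive = trans (tabulate-cong inverse≗σ) (tabulate∘lookup σ)
    where
    inverse≗σ : ∀ y → inverse (app (σ ⁻¹)) y ≡ app σ y
    inverse≗σ y = ⁻¹-injective (trans (inverseʳ ⁻¹-injective y) (sym (⁻¹-inverseˡ y)))

  cycles-⁻¹ : cycles (σ ⁻¹) ≡ cycles σ
  cycles-⁻¹ = begin
    cycles (σ ⁻¹)                   ≡⟨ cycles≡cycleCount (σ ⁻¹) ⟩
    cycleCount (app (σ ⁻¹))         ≡⟨ cycleCount-cong (lookup∘tabulate (inverse (app σ))) ⟩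
    cycleCount (inverse (app σ))    ≡⟨ cycleCount-inverse σ-inj ⟩
    cycleCount (app σ)              ≡⟨ cycles≡cycleCount σ ⟨
    cycles σ                        ∎
    where open ≡-Reasoning

  iter-⁻¹-fixed : ∀ j x → (iter j (σ ⁻¹) x == x) ≡ (iter j σ x == x)
  iter-⁻¹-fixed j x = T-ext (≡⇒== ∘ fixed-by-inverse (σ ⁻¹) σ ⁻¹-inverseʳ ∘ ==⇒≡)
                            (≡⇒== ∘ fixed-by-inverse σ (σ ⁻¹) ⁻¹-inverseˡ ∘ ==⇒≡)
    where
    fixed-by-inverse : (τ ρ : Endo N) → (∀ z → app ρ (app τ z) ≡ z) → iter j τ x ≡ x → iter j ρ x ≡ x
    fixed-by-inverse τ ρ ρτ≗id τʲx≡x = begin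
      iter j ρ x                                     ≡⟨ iter≡iterate j ρ x ⟩
      iterate j (app ρ) x                            ≡⟨ cong (iterate j (app ρ)) (trans (sym (iter≡iterate j τ x)) τʲx≡x) ⟨
      iterate j (app ρ) (iterate j (app τ) x)        ≡⟨ iterate-retraction ρτ≗id j x ⟩
      x                                              ∎
      where open ≡-Reasoning

isPerm-⁻¹ : (σ : Endo N) → T (isPerm σ) → T (isPerm (σ ⁻¹))
isPerm-⁻¹ σ t = isPerm⁺ (σ ⁻¹) (⁻¹-injective σ (isPerm⁻ σ t))

productIsId⁻ : (σ₀ σ₁ σ₂ : Endo N) → T (productIsId σ₀ σ₁ σ₂) → ∀ x → app σ₀ (app σ₁ (app σ₂ x)) ≡ x
productIsId⁻ σ₀ σ₁ σ₂ t x = ==⇒≡ (allL-elems⁻ t x)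

productIsId⁺ : (σ₀ σ₁ σ₂ : Endo N) → (∀ x → app σ₀ (app σ₁ (app σ₂ x)) ≡ x) → T (productIsId σ₀ σ₁ σ₂)
productIsId⁺ σ₀ σ₁ σ₂ σ₀σ₁σ₂≗id = allL-elems⁺ (≡⇒== ∘ σ₀σ₁σ₂≗id)

productIsId-⁻¹ : (σ₀ σ₁ σ₂ : Endo N) → Injective _≡_ _≡_ (app σ₀) → Injective _≡_ _≡_ (app σ₁) →
  Injective _≡_ _≡_ (app σ₂) → T (productIsId σ₀ σ₁ σ₂) → T (productIsId (σ₁ ⁻¹) (σ₀ ⁻¹) (σ₂ ⁻¹))
productIsId-⁻¹ σ₀ σ₁ σ₂ σ₀-inj σ₁-inj σ₂-inj t = productIsId⁺ (σ₁ ⁻¹) (σ₀ ⁻¹) (σ₂ ⁻¹) λ x → begin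
  app (σ₁ ⁻¹) (app (σ₀ ⁻¹) (app (σ₂ ⁻¹) x))                   ≡⟨ cong (app (σ₁ ⁻¹) ∘ app (σ₀ ⁻¹)) (σ₀σ₁≗σ₂⁻¹ x) ⟨
  app (σ₁ ⁻¹) (app (σ₀ ⁻¹) (app σ₀ (app σ₁ x)))               ≡⟨ cong (app (σ₁ ⁻¹)) (⁻¹-inverseˡ σ₀ σ₀-inj _) ⟩
  app (σ₁ ⁻¹) (app σ₁ x)                                      ≡⟨ ⁻¹-inverseˡ σ₁ σ₁-inj x ⟩
  x                                                           ∎
  where
  open ≡-Reasoning
  σ₀σ₁≗σ₂⁻¹ : ∀ x → app σ₀ (app σ₁ x) ≡ app (σ₂ ⁻¹) x
  σ₀σ₁≗σ₂⁻¹ x = trans (cong (app σ₀ ∘ app σ₁) (sym (⁻¹-inverseʳ σ₂ σ₂-inj x))) (productIsId⁻ σ₀ σ₁ σ₂ t _)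

data Reach (a b : Endo N) : ℕ → Fin N → Fin N → Set where
  here  : ∀ {d x}   → Reach a b d x x
  stepᵃ : ∀ {d x y} → Reach a b d (app a x) y → Reach a b (suc d) x y
  stepᵇ : ∀ {d x y} → Reach a b d (app b x) y → Reach a b (suc d) x y

module _ {a b : Endo N} where

  reach⁺ : ∀ {d x y} → Reach a b d x y → T (reach d a b x y)
  reach⁺ {zero}      here      = ≡⇒== refl
  reach⁺ {suc d} {x} here      = T-∨-introˡ (reach d a b (app a x) x ∨ reach d a b (app b x) x) (≡⇒== {x = x} refl)
  reach⁺ {suc d} {x} {y} (stepᵃ r) = T-∨-introʳ (x == y) (T-∨-introˡ (reach d a b (app b x) y) (reach⁺ r))
  reach⁺ {suc d} {x} {y} (stepᵇ r) = T-∨-introʳ (x == y) (T-∨-introʳ (reach d a b (app a x) y) (reach⁺ r))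

  reach⁻ : ∀ d {x y} → T (reach d a b x y) → Reach a b d x y
  reach⁻ zero {x} {y} t with refl ← ==⇒≡ {x = x} {y} t = here
  reach⁻ (suc d) {x} {y} t with T-∨-elim (x == y) t
  ... | inj₁ x==y with refl ← ==⇒≡ {x = x} {y} x==y = here
  ... | inj₂ t′ with T-∨-elim (reach d a b (app a x) y) t′
  ...   | inj₁ via-a = stepᵃ (reach⁻ d via-a)
  ...   | inj₂ via-b = stepᵇ (reach⁻ d via-b)

  Reach-snoc : ∀ {d u v w} → Reach a b d u v → app a v ≡ w ⊎ app b v ≡ w → Reach a b (suc d) u w
  Reach-snoc {zero}  here (inj₁ refl) = stepᵃ here
  Reach-snoc {zero}  here (inj₂ refl) = stepᵇ here
  Reach-snoc {suc d} here (inj₁ refl) = stepᵃ here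
  Reach-snoc {suc d} here (inj₂ refl) = stepᵇ here
  Reach-snoc (stepᵃ r) last = stepᵃ (Reach-snoc r last)
  Reach-snoc (stepᵇ r) last = stepᵇ (Reach-snoc r last)

  Reach-iterate : ∀ j d {x} → j ≤ d → Reach a b d x (iterate j (app a) x)
  Reach-iterate zero    d       _         = here
  Reach-iterate (suc j) (suc d) {x} (s≤s j≤d) =
    stepᵃ (subst (Reach a b d (app a x)) (sym (iterate-suc j (app a) x)) (Reach-iterate j d j≤d))

Reach-reverse : ∀ {a b a′ b′ : Endo N} → (∀ z → app a′ (app a z) ≡ z) → (∀ z → app b′ (app b z) ≡ z) →
  ∀ {d x y} → Reach a b d x y → Reach b′ a′ d y x
Reach-reverse a′a b′b here = here
Reach-reverse a′a b′b {x = x} (stepᵃ r) = Reach-snoc (Reach-reverse a′a b′b r) (inj₂ (a′a x))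
Reach-reverse a′a b′b {x = x} (stepᵇ r) = Reach-snoc (Reach-reverse a′a b′b r) (inj₁ (b′b x))

transitive⁻ : (a b : Endo N) → T (transitive a b) → ∀ x y → T (reach N a b x y)
transitive⁻ {N} a b t x = allL-elems⁻ {p = reach N a b x} (allL-elems⁻ {p = λ x → allL (reach N a b x) (elems N)} t x)

transitive⁺ : (a b : Endo N) → (∀ x y → T (reach N a b x y)) → T (transitive a b)
transitive⁺ a b reached = allL-elems⁺ (allL-elems⁺ ∘ reached)

transitive-⁻¹ : (σ₀ σ₁ : Endo N) → Injective _≡_ _≡_ (app σ₀) → Injective _≡_ _≡_ (app σ₁) →
  T (transitive σ₀ σ₁) → T (transitive (σ₁ ⁻¹) (σ₀ ⁻¹))
transitive-⁻¹ {N} σ₀ σ₁ σ₀-inj σ₁-inj t = transitive⁺ (σ₁ ⁻¹) (σ₀ ⁻¹) λ y x →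
  reach⁺ (Reach-reverse (⁻¹-inverseˡ σ₀ σ₀-inj) (⁻¹-inverseˡ σ₁ σ₁-inj) (reach⁻ N (transitive⁻ σ₀ σ₁ t x y)))

transitive-singleOrbit : (σ₀ σ₁ : Endo N) → Injective _≡_ _≡_ (app σ₀) → SingleOrbit (app σ₀) → T (transitive σ₀ σ₁)
transitive-singleOrbit {N} σ₀ σ₁ σ₀-inj single = transitive⁺ σ₀ σ₁ reached
  where
  reached : ∀ x y → T (reach N σ₀ σ₁ x y)
  reached x y with j , σ₀ʲx≡y ← single x y with j′ , j′<N , σ₀ʲx≡σ₀ʲ′x ← iterate-below σ₀-inj x j =
    reach⁺ (subst (Reach σ₀ σ₁ N x) (trans (sym σ₀ʲx≡σ₀ʲ′x) σ₀ʲx≡y) (Reach-iterate j′ N (<⇒≤ j′<N)))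

faceLabelling-⁻¹ : ∀ {n} (μ : Vec ℕ n) (σ : Endo N) (f : Vec (Fin n) N) → Injective _≡_ _≡_ (app σ) →
  T (faceLabelling μ σ f) → T (faceLabelling μ (σ ⁻¹) f)
faceLabelling-⁻¹ {N} {n} μ σ f σ-inj t with T-∧-elim t
... | f-invariant , rest = T-∧-intro f-invariant-⁻¹ (subst T (cong (_ ∧_) (sym exact-periods-⁻¹)) rest)
  where
  degree : Fin N → ℕ
  degree x = lookup μ (lookup f x)
  exact-period : Endo N → Fin N → Bool
  exact-period τ x = (iter (degree x) τ x == x) ∧ allL (λ j → (j ≡ᵇ 0) ∨ not (iter j τ x == x)) (upTo (degree x))
  f-invariant-⁻¹ : T (allL (λ x → lookup f (app (σ ⁻¹) x) == lookup f x) (elems N))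
  f-invariant-⁻¹ = allL-elems⁺ λ x → ≡⇒== (sym (trans (cong (lookup f) (sym (⁻¹-inverseʳ σ σ-inj x)))
    (==⇒≡ (allL-elems⁻ {p = λ x → lookup f (app σ x) == lookup f x} f-invariant (app (σ ⁻¹) x)))))
  exact-periods-⁻¹ : allL (exact-period (σ ⁻¹)) (elems N) ≡ allL (exact-period σ) (elems N)
  exact-periods-⁻¹ = allL-cong (λ x → cong₂ _∧_ (iter-⁻¹-fixed σ σ-inj (degree x) x)
    (allL-cong (λ j → cong (λ b → (j ≡ᵇ 0) ∨ not b) (iter-⁻¹-fixed σ σ-inj j x)) (upTo (degree x)))) (elems N)

-- Opaque, so that its arguments can be inferred from its type; it is unfolded only to identify the
-- summand of dessinCount and to reflect it into IsDessin.
opaque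
  isDessinᵇ : (g n : ℕ) (μ : Vec ℕ n) (k : ℕ) (σ₀ σ₁ σ₂ : Endo (size μ)) → Vec (Fin n) (size μ) → Bool
  isDessinᵇ g n μ k σ₀ σ₁ σ₂ f =
    productIsId σ₀ σ₁ σ₂ ∧ (transitive σ₀ σ₁ ∧ (faceLabelling μ σ₂ f
      ∧ ((cycles σ₀ ≡ᵇ k) ∧ (cycles σ₀ + cycles σ₁ + n + 2 * g ≡ᵇ size μ + 2))))

record IsDessin (g n : ℕ) (μ : Vec ℕ n) (k : ℕ) (σ₀ σ₁ σ₂ : Endo (size μ)) (f : Vec (Fin n) (size μ)) : Set where
  field
    product   : T (productIsId σ₀ σ₁ σ₂)
    connected : T (transitive σ₀ σ₁)
    faces     : T (faceLabelling μ σ₂ f)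
    black     : cycles σ₀ ≡ k
    euler     : cycles σ₀ + cycles σ₁ + n + 2 * g ≡ size μ + 2

opaque
  unfolding isDessinᵇ

  dessinCount≡ : ∀ g n (μ : Vec ℕ n) k → dessinCount g n μ k ≡
    sumL (map (λ σ₀ → sumL (map (λ σ₁ → sumL (map (λ σ₂ →
      countL (isDessinᵇ g n μ k σ₀ σ₁ σ₂) (allVecs (elems n) (size μ)))
      (perms (size μ)))) (perms (size μ)))) (perms (size μ)))
  dessinCount≡ g n μ k = refl

  isDessinᵇ⁻ : ∀ {g n} {μ : Vec ℕ n} {k} {σ₀ σ₁ σ₂ : Endo (size μ)} {f} →
    T (isDessinᵇ g n μ k σ₀ σ₁ σ₂ f) → IsDessin g n μ k σ₀ σ₁ σ₂ f
  isDessinᵇ⁻ t with T-∧-elim t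
  ... | product , t₁ with T-∧-elim t₁
  ...   | connected , t₂ with T-∧-elim t₂
  ...     | faces , t₃ with T-∧-elim t₃
  ...       | black , euler = record
    { product = product ; connected = connected ; faces = faces
    ; black = ≡ᵇ⇒≡ _ _ black ; euler = ≡ᵇ⇒≡ _ _ euler }

  isDessinᵇ⁺ : ∀ {g n} {μ : Vec ℕ n} {k} {σ₀ σ₁ σ₂ : Endo (size μ)} {f} →
    IsDessin g n μ k σ₀ σ₁ σ₂ f → T (isDessinᵇ g n μ k σ₀ σ₁ σ₂ f)
  isDessinᵇ⁺ d = T-∧-intro product (T-∧-intro connected (T-∧-intro faces
    (T-∧-intro (≡⇒≡ᵇ _ _ black) (≡⇒≡ᵇ _ _ euler))))
    where open IsDessin d

-- By Euler's formula, the number b + w of vertices of every dessin counted by dessinCount g n μ.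
vertexCount : (g n : ℕ) → Vec ℕ n → ℕ
vertexCount g n μ = size μ + 2 ∸ (2 * g + n)

euler⇒white : ∀ {b w n g M} → b + w + n + 2 * g ≡ M → w ≡ M ∸ (2 * g + n) ∸ b
euler⇒white {b} {w} {n} {g} {M} eq = sym (begin
  M ∸ (2 * g + n) ∸ b                        ≡⟨ cong (λ m → m ∸ (2 * g + n) ∸ b) eq ⟨
  b + w + n + 2 * g ∸ (2 * g + n) ∸ b        ≡⟨ cong (λ m → m ∸ (2 * g + n) ∸ b) (reassoc b w n (2 * g)) ⟩
  b + w + (2 * g + n) ∸ (2 * g + n) ∸ b      ≡⟨ cong (_∸ b) (m+n∸n≡m (b + w) (2 * g + n)) ⟩
  b + w ∸ b                                  ≡⟨ m+n∸m≡n b w ⟩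
  w                                          ∎)
  where
  open ≡-Reasoning
  reassoc : ∀ b w n h → b + w + n + h ≡ b + w + (h + n)
  reassoc b w n h = trans (+-assoc (b + w) n h) (cong (b + w +_) (+-comm n h))

module _ {g n : ℕ} {μ : Vec ℕ n} {σ₀ σ₁ σ₂ : Endo (size μ)}
         (σ₀-inj : Injective _≡_ _≡_ (app σ₀)) (σ₁-inj : Injective _≡_ _≡_ (app σ₁))
         (σ₂-inj : Injective _≡_ _≡_ (app σ₂)) where

  IsDessin-dual : ∀ {k f} → IsDessin g n μ k σ₀ σ₁ σ₂ f →
    IsDessin g n μ (vertexCount g n μ ∸ k) (σ₁ ⁻¹) (σ₀ ⁻¹) (σ₂ ⁻¹) f
  IsDessin-dual {k} {f} d = record
    { product   = productIsId-⁻¹ σ₀ σ₁ σ₂ σ₀-inj σ₁-inj σ₂-inj product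
    ; connected = transitive-⁻¹ σ₀ σ₁ σ₀-inj σ₁-inj connected
    ; faces     = faceLabelling-⁻¹ μ σ₂ f σ₂-inj faces
    ; black     = trans (cycles-⁻¹ σ₁ σ₁-inj) (subst (λ b → cycles σ₁ ≡ vertexCount g n μ ∸ b) black (euler⇒white {cycles σ₀} {cycles σ₁} {n} {g} euler))
    ; euler     = trans (cong₂ (λ b w → b + w + n + 2 * g) (cycles-⁻¹ σ₁ σ₁-inj) (cycles-⁻¹ σ₀ σ₀-inj))
                        (trans (cong (λ m → m + n + 2 * g) (+-comm (cycles σ₁) (cycles σ₀))) euler) }
    where open IsDessin d

isDessinᵇ-dual : ∀ {g n} {μ : Vec ℕ n} {k} {σ₀ σ₁ σ₂ : Endo (size μ)} → k ≤ vertexCount g n μ →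
  T (isPerm σ₀) → T (isPerm σ₁) → T (isPerm σ₂) → ∀ f →
  isDessinᵇ g n μ k σ₀ σ₁ σ₂ f ≡ isDessinᵇ g n μ (vertexCount g n μ ∸ k) (σ₁ ⁻¹) (σ₀ ⁻¹) (σ₂ ⁻¹) f
isDessinᵇ-dual {g} {n} {μ} {k} {σ₀} {σ₁} {σ₂} k≤m p₀ p₁ p₂ f = T-ext dual undual
  where
  i₀ : Injective _≡_ _≡_ (app σ₀)
  i₀ = isPerm⁻ σ₀ p₀
  i₁ : Injective _≡_ _≡_ (app σ₁)
  i₁ = isPerm⁻ σ₁ p₁
  i₂ : Injective _≡_ _≡_ (app σ₂)
  i₂ = isPerm⁻ σ₂ p₂
  m : ℕ
  m = vertexCount g n μ
  dual : T (isDessinᵇ g n μ k σ₀ σ₁ σ₂ f) → T (isDessinᵇ g n μ (m ∸ k) (σ₁ ⁻¹) (σ₀ ⁻¹) (σ₂ ⁻¹) f)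
  dual t = isDessinᵇ⁺ (IsDessin-dual i₀ i₁ i₂ (isDessinᵇ⁻ t))
  undual : T (isDessinᵇ g n μ (m ∸ k) (σ₁ ⁻¹) (σ₀ ⁻¹) (σ₂ ⁻¹) f) → T (isDessinᵇ g n μ k σ₀ σ₁ σ₂ f)
  undual t = redual (IsDessin-dual (⁻¹-injective σ₁ i₁) (⁻¹-injective σ₀ i₀) (⁻¹-injective σ₂ i₂) (isDessinᵇ⁻ t))
    where
    redual : IsDessin g n μ (m ∸ (m ∸ k)) ((σ₀ ⁻¹) ⁻¹) ((σ₁ ⁻¹) ⁻¹) ((σ₂ ⁻¹) ⁻¹) f → T (isDessinᵇ g n μ k σ₀ σ₁ σ₂ f)
    redual d rewrite m∸[m∸n]≡n k≤m | ⁻¹-involutive σ₀ i₀ | ⁻¹-involutive σ₁ i₁ | ⁻¹-involutive σ₂ i₂ = isDessinᵇ⁺ d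

dessinCount-symmetric : ∀ g n (μ : Vec ℕ n) k → k ≤ vertexCount g n μ →
  dessinCount g n μ k ≡ dessinCount g n μ (vertexCount g n μ ∸ k)
dessinCount-symmetric g n μ k k≤m = begin
  dessinCount g n μ k
    ≡⟨ dessinCount≡ g n μ k ⟩
  Σ[ σ₀ ] Σ[ σ₁ ] Σ[ σ₂ ] count k σ₀ σ₁ σ₂
    ≡⟨ sumL-filterᵇ-cong isPerm (λ σ₀ p₀ → sumL-filterᵇ-cong isPerm (λ σ₁ p₁ → sumL-filterᵇ-cong isPerm (λ σ₂ p₂ →
         countL-cong (isDessinᵇ-dual {g} {n} {μ} k≤m p₀ p₁ p₂) W) V) V) V ⟩
  Σ[ σ₀ ] Σ[ σ₁ ] Σ[ σ₂ ] count k′ (σ₁ ⁻¹) (σ₀ ⁻¹) (σ₂ ⁻¹)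
    ≡⟨ sumL-cong (λ σ₀ → sumL-cong (λ σ₁ → reindex (count k′ (σ₁ ⁻¹) (σ₀ ⁻¹))) P) P ⟩
  Σ[ σ₀ ] Σ[ σ₁ ] Σ[ σ₂ ] count k′ (σ₁ ⁻¹) (σ₀ ⁻¹) σ₂
    ≡⟨ sumL-cong (λ σ₀ → reindex (λ σ₁ → Σ[ σ₂ ] count k′ σ₁ (σ₀ ⁻¹) σ₂)) P ⟩
  Σ[ σ₀ ] Σ[ σ₁ ] Σ[ σ₂ ] count k′ σ₁ (σ₀ ⁻¹) σ₂
    ≡⟨ reindex (λ σ₀ → Σ[ σ₁ ] Σ[ σ₂ ] count k′ σ₁ σ₀ σ₂) ⟩
  Σ[ σ₀ ] Σ[ σ₁ ] Σ[ σ₂ ] count k′ σ₁ σ₀ σ₂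
    ≡⟨ sumL-swap (λ σ₀ σ₁ → Σ[ σ₂ ] count k′ σ₁ σ₀ σ₂) P P ⟩
  Σ[ σ₁ ] Σ[ σ₀ ] Σ[ σ₂ ] count k′ σ₁ σ₀ σ₂
    ≡⟨ dessinCount≡ g n μ k′ ⟨
  dessinCount g n μ k′
    ∎
  where
  open ≡-Reasoning
  V P : List (Endo (size μ))
  V = allVecs (elems (size μ)) (size μ)
  P = perms (size μ)
  W : List (Vec (Fin n) (size μ))
  W = allVecs (elems n) (size μ)
  k′ : ℕ
  k′ = vertexCount g n μ ∸ k
  Σ-syntax : (Endo (size μ) → ℕ) → ℕ
  Σ-syntax F = sumL (map F P)
  syntax Σ-syntax (λ σ → F) = Σ[ σ ] F
  count : ℕ → Endo (size μ) → Endo (size μ) → Endo (size μ) → ℕ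
  count k σ₀ σ₁ σ₂ = countL (isDessinᵇ g n μ k σ₀ σ₁ σ₂) W
  reindex : (F : Endo (size μ) → ℕ) → Σ[ σ ] F (σ ⁻¹) ≡ Σ[ σ ] F σ
  reindex = sumL-filterᵇ-involution {xs = V} (enumerates-allVecs (enumerates-elems (size μ)) (size μ)) isPerm {_⁻¹}
    (λ {σ} → isPerm-⁻¹ σ) (λ {σ} p → ⁻¹-involutive σ (isPerm⁻ σ p))

-- Growing a dessin with a single black vertex

extend : (Fin N → B) → B → Fin (suc N) → B
extend {zero}  f b zero    = b
extend {suc N} f b zero    = f zero
extend {suc N} f b (suc i) = extend (f ∘ suc) b i

extend-inject₁ : (f : Fin N → B) (b : B) (x : Fin N) → extend f b (inject₁ x) ≡ f x
extend-inject₁ {suc N} f b zero    = refl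
extend-inject₁ {suc N} f b (suc x) = extend-inject₁ (f ∘ suc) b x

extend-fromℕ : (f : Fin N → B) (b : B) → extend f b (fromℕ N) ≡ b
extend-fromℕ {zero}  f b = refl
extend-fromℕ {suc N} f b = extend-fromℕ (f ∘ suc) b

data LastView : Fin (suc N) → Set where
  old : (x : Fin N) → LastView (inject₁ x)
  new : LastView (fromℕ N)

lastView : (i : Fin (suc N)) → LastView i
lastView {zero}  zero    = new
lastView {suc N} zero    = old zero
lastView {suc N} (suc i) with lastView i
... | old x = old (suc x)
... | new   = new

sumL-elems-last : (F : Fin (suc N) → ℕ) →
  sumL (map F (elems (suc N))) ≡ sumL (map (F ∘ inject₁) (elems N)) + F (fromℕ N)
sumL-elems-last {zero}  F = +-comm (F zero) 0
sumL-elems-last {suc N} F = begin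
  sumL (map F (elems (suc (suc N))))                                    ≡⟨ sumL-elems-suc F ⟩
  F zero + sumL (map (F ∘ suc) (elems (suc N)))                         ≡⟨ cong (F zero +_) (sumL-elems-last (F ∘ suc)) ⟩
  F zero + (sumL (map (F ∘ suc ∘ inject₁) (elems N)) + F (fromℕ (suc N))) ≡⟨ +-assoc (F zero) _ _ ⟨
  F zero + sumL (map (F ∘ inject₁ ∘ suc) (elems N)) + F (fromℕ (suc N))   ≡⟨ cong (_+ F (fromℕ (suc N))) (sumL-elems-suc (F ∘ inject₁)) ⟨
  sumL (map (F ∘ inject₁) (elems (suc N))) + F (fromℕ (suc N))          ∎
  where open ≡-Reasoning

insertAfter : Fin N → (Fin N → Fin N) → Fin (suc N) → Fin (suc N)
insertAfter {N} a s = extend (λ x → if x == a then fromℕ N else inject₁ (s x)) (inject₁ (s a))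

addFixedPoint : (Fin N → Fin N) → Fin (suc N) → Fin (suc N)
addFixedPoint {N} s = extend (inject₁ ∘ s) (fromℕ N)

module _ (a : Fin N) (s : Fin N → Fin N) where

  insertAfter-at : insertAfter a s (inject₁ a) ≡ fromℕ N
  insertAfter-at = trans (extend-inject₁ _ _ a) (cong (if_then fromℕ N else inject₁ (s a)) (==-true {x = a} refl))

  insertAfter-other : ∀ {x} → x ≢ a → insertAfter a s (inject₁ x) ≡ inject₁ (s x)
  insertAfter-other {x} x≢a = trans (extend-inject₁ _ _ x) (cong (if_then fromℕ N else inject₁ (s x)) (==-false x≢a))

  insertAfter-fromℕ : insertAfter a s (fromℕ N) ≡ inject₁ (s a)
  insertAfter-fromℕ = extend-fromℕ (λ x → if x == a then fromℕ N else inject₁ (s x)) (inject₁ (s a))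

insertAfter-retraction : ∀ {s t : Fin N → Fin N} (a : Fin N) → (∀ x → t (s x) ≡ x) →
  ∀ u → insertAfter (s a) t (insertAfter a s u) ≡ u
insertAfter-retraction {N} {s} {t} a ts≗id u with lastView u
... | new = trans (cong (insertAfter (s a) t) (insertAfter-fromℕ a s)) (insertAfter-at (s a) t)
... | old x with x ≟ a
...   | yes refl = trans (cong (insertAfter (s x) t) (insertAfter-at x s))
                         (trans (insertAfter-fromℕ (s x) t) (cong inject₁ (ts≗id x)))
...   | no  x≢a  = trans (cong (insertAfter (s a) t) (insertAfter-other a s x≢a))
                         (trans (insertAfter-other (s a) t (x≢a ∘ sx≡sa⇒x≡a)) (cong inject₁ (ts≗id x)))
  where
  sx≡sa⇒x≡a : s x ≡ s a → x ≡ a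
  sx≡sa⇒x≡a = retraction⇒injective {t = t} ts≗id

insertAfter-injective : ∀ {s : Fin N → Fin N} (a : Fin N) → Injective _≡_ _≡_ s → Injective _≡_ _≡_ (insertAfter a s)
insertAfter-injective {s = s} a s-inj =
  retraction⇒injective {t = insertAfter (s a) (inverse s)} (insertAfter-retraction a (inverseˡ s-inj))

addFixedPoint-inject₁ : ∀ (s : Fin N → Fin N) x → addFixedPoint s (inject₁ x) ≡ inject₁ (s x)
addFixedPoint-inject₁ {N} s = extend-inject₁ (inject₁ ∘ s) (fromℕ N)

addFixedPoint-fromℕ : ∀ (s : Fin N → Fin N) → addFixedPoint s (fromℕ N) ≡ fromℕ N
addFixedPoint-fromℕ {N} s = extend-fromℕ (inject₁ ∘ s) (fromℕ N)

addFixedPoint-retraction : ∀ {s t : Fin N → Fin N} → (∀ x → t (s x) ≡ x) →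
  ∀ u → addFixedPoint t (addFixedPoint s u) ≡ u
addFixedPoint-retraction {s = s} {t} ts≗id u with lastView u
... | new   = trans (cong (addFixedPoint t) (addFixedPoint-fromℕ s)) (addFixedPoint-fromℕ t)
... | old x = trans (cong (addFixedPoint t) (addFixedPoint-inject₁ s x))
                    (trans (addFixedPoint-inject₁ t (s x)) (cong inject₁ (ts≗id x)))

addFixedPoint-injective : ∀ {s : Fin N → Fin N} → Injective _≡_ _≡_ s → Injective _≡_ _≡_ (addFixedPoint s)
addFixedPoint-injective {s = s} s-inj =
  retraction⇒injective {t = addFixedPoint (inverse s)} (addFixedPoint-retraction (inverseˡ s-inj))

module _ (a : Fin N) (s : Fin N → Fin N) where

  private
    s′ : Fin (suc N) → Fin (suc N)
    s′ = insertAfter a s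

  iterate-insertAfter-avoiding : ∀ t z → (∀ i → i < t → iterate i s z ≢ a) →
    iterate t s′ (inject₁ z) ≡ inject₁ (iterate t s z)
  iterate-insertAfter-avoiding zero    z avoids = refl
  iterate-insertAfter-avoiding (suc t) z avoids =
    trans (cong s′ (iterate-insertAfter-avoiding t z (λ i i<t → avoids i (m≤n⇒m≤1+n i<t))))
          (insertAfter-other a s (avoids t ≤-refl))

  InOrbit-insertAfter-step : ∀ y → InOrbit s′ (inject₁ y) (inject₁ (s y))
  InOrbit-insertAfter-step y with y ≟ a
  ... | yes refl = 2 , trans (cong s′ (insertAfter-at y s)) (insertAfter-fromℕ y s)
  ... | no  y≢a  = 1 , insertAfter-other a s y≢a

  InOrbit-insertAfter⁺ : ∀ {x y} → InOrbit s x y → InOrbit s′ (inject₁ x) (inject₁ y)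
  InOrbit-insertAfter⁺ (zero  , refl) = 0 , refl
  InOrbit-insertAfter⁺ (suc j , refl) = InOrbit-trans (InOrbit-insertAfter⁺ (j , refl)) (InOrbit-insertAfter-step _)

  InOrbit-insertAfter⁻ : ∀ {x u} → InOrbit s′ (inject₁ x) u →
    (u ≡ fromℕ N × InOrbit s x a) ⊎ ∃[ y ] u ≡ inject₁ y × InOrbit s x y
  InOrbit-insertAfter⁻ {x} (zero , refl) = inj₂ (x , refl , 0 , refl)
  InOrbit-insertAfter⁻ (suc j , refl) with InOrbit-insertAfter⁻ (j , refl)
  ... | inj₁ (eq , x↝a) = inj₂ (s a , trans (cong s′ eq) (insertAfter-fromℕ a s) , InOrbit-step x↝a)
  ... | inj₂ (y , eq , x↝y) with y ≟ a
  ...   | yes refl = inj₁ (trans (cong s′ eq) (insertAfter-at y s) , x↝y)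
  ...   | no  y≢a  = inj₂ (s y , trans (cong s′ eq) (insertAfter-other a s y≢a) , InOrbit-step x↝y)

  -- The inserted point has the largest index, so it never is the minimum of an old cycle.
  orbitMinᵇ-insertAfter-inject₁ : Injective _≡_ _≡_ s → ∀ x → orbitMinᵇ s′ (inject₁ x) ≡ orbitMinᵇ s x
  orbitMinᵇ-insertAfter-inject₁ s-inj x = orbitMinᵇ-≡ (insertAfter-injective a s-inj) s-inj from-s to-s
    where
    from-s : IsOrbitMin s′ (inject₁ x) → IsOrbitMin s x
    from-s x-min x↝y = subst₂ _≤_ (toℕ-inject₁ x) (toℕ-inject₁ _) (x-min (InOrbit-insertAfter⁺ x↝y))
    to-s : IsOrbitMin s x → IsOrbitMin s′ (inject₁ x)
    to-s x-min x↝u with InOrbit-insertAfter⁻ x↝u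
    ... | inj₁ (refl , _)    = subst₂ _≤_ (sym (toℕ-inject₁ x)) (sym (toℕ-fromℕ N)) (<⇒≤ (toℕ<n x))
    ... | inj₂ (y , refl , x↝y) = subst₂ _≤_ (sym (toℕ-inject₁ x)) (sym (toℕ-inject₁ y)) (x-min x↝y)

  insertAfter-fromℕ-decreases : toℕ (s′ (fromℕ N)) < toℕ (fromℕ N)
  insertAfter-fromℕ-decreases =
    subst₂ _<_ (sym (trans (cong toℕ (insertAfter-fromℕ a s)) (toℕ-inject₁ (s a)))) (sym (toℕ-fromℕ N)) (toℕ<n (s a))

  orbitMinᵇ-insertAfter-fromℕ : Injective _≡_ _≡_ s → orbitMinᵇ s′ (fromℕ N) ≡ false
  orbitMinᵇ-insertAfter-fromℕ s-inj with orbitMinᵇ s′ (fromℕ N) in eq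
  ... | false = refl
  ... | true with () ← <⇒≱ insertAfter-fromℕ-decreases
                     (orbitMinᵇ⁻ (insertAfter-injective a s-inj) (subst T (sym eq) _) (1 , refl))

  cycleCount-insertAfter : Injective _≡_ _≡_ s → cycleCount s′ ≡ cycleCount s
  cycleCount-insertAfter s-inj = begin
    cycleCount s′                                                                      ≡⟨ sumL-elems-last (λ u → iverson (orbitMinᵇ s′ u) 1) ⟩
    countL (orbitMinᵇ s′ ∘ inject₁) (elems N) + iverson (orbitMinᵇ s′ (fromℕ N)) 1     ≡⟨ cong₂ _+_
      (countL-cong (orbitMinᵇ-insertAfter-inject₁ s-inj) (elems N)) (cong (λ b → iverson b 1) (orbitMinᵇ-insertAfter-fromℕ s-inj)) ⟩
    cycleCount s + 0                                                                   ≡⟨ +-identityʳ _ ⟩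
    cycleCount s                                                                       ∎
    where open ≡-Reasoning

  singleOrbit-insertAfter : SingleOrbit s → SingleOrbit s′
  singleOrbit-insertAfter single u v = InOrbit-trans (to-a u) (from-a v)
    where
    to-a : ∀ u → InOrbit s′ u (inject₁ a)
    to-a u with lastView u
    ... | old x = InOrbit-insertAfter⁺ (single x a)
    ... | new   = InOrbit-trans (1 , insertAfter-fromℕ a s) (InOrbit-insertAfter⁺ (single (s a) a))
    from-a : ∀ v → InOrbit s′ (inject₁ a) v
    from-a v with lastView v
    ... | old y = InOrbit-insertAfter⁺ (single a y)
    ... | new   = 1 , insertAfter-at a s

module _ (s : Fin N → Fin N) where

  private
    s′ : Fin (suc N) → Fin (suc N)
    s′ = addFixedPoint s

  iterate-addFixedPoint-inject₁ : ∀ j x → iterate j s′ (inject₁ x) ≡ inject₁ (iterate j s x)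
  iterate-addFixedPoint-inject₁ zero    x = refl
  iterate-addFixedPoint-inject₁ (suc j) x = trans (cong s′ (iterate-addFixedPoint-inject₁ j x)) (addFixedPoint-inject₁ s _)

  iterate-addFixedPoint-fromℕ : ∀ j → iterate j s′ (fromℕ N) ≡ fromℕ N
  iterate-addFixedPoint-fromℕ zero    = refl
  iterate-addFixedPoint-fromℕ (suc j) = trans (cong s′ (iterate-addFixedPoint-fromℕ j)) (addFixedPoint-fromℕ s)

  cycleCount-addFixedPoint : Injective _≡_ _≡_ s → cycleCount s′ ≡ cycleCount s + 1
  cycleCount-addFixedPoint s-inj = begin
    cycleCount s′                                                                  ≡⟨ sumL-elems-last (λ u → iverson (orbitMinᵇ s′ u) 1) ⟩
    countL (orbitMinᵇ s′ ∘ inject₁) (elems N) + iverson (orbitMinᵇ s′ (fromℕ N)) 1 ≡⟨ cong₂ _+_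
      (countL-cong old-min (elems N)) (cong (λ b → iverson b 1) new-min) ⟩
    cycleCount s + 1                                                               ∎
    where
    open ≡-Reasoning
    old-min : ∀ x → orbitMinᵇ s′ (inject₁ x) ≡ orbitMinᵇ s x
    old-min x = orbitMinᵇ-≡ (addFixedPoint-injective s-inj) s-inj
      (λ x-min {y} (j , x↝y) → subst₂ _≤_ (toℕ-inject₁ x)
        (trans (cong toℕ (iterate-addFixedPoint-inject₁ j x)) (trans (toℕ-inject₁ _) (cong toℕ x↝y)))
        (x-min (j , refl)))
      (λ x-min {u} (j , x↝u) → subst₂ _≤_ (sym (toℕ-inject₁ x))
        (trans (sym (toℕ-inject₁ _)) (trans (cong toℕ (sym (iterate-addFixedPoint-inject₁ j x))) (cong toℕ x↝u)))
        (x-min (j , refl)))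
    new-min : orbitMinᵇ s′ (fromℕ N) ≡ true
    new-min = Equivalence.to T-≡ (orbitMinᵇ⁺ λ { (j , refl) → ≤-reflexive (cong toℕ (sym (iterate-addFixedPoint-fromℕ j))) })

ExactPeriod : (A → A) → A → ℕ → Set
ExactPeriod s x P = iterate P s x ≡ x × (∀ j → 0 < j → j < P → iterate j s x ≢ x)

ExactPeriod-InOrbit : ∀ {s : Fin N → Fin N} → Injective _≡_ _≡_ s →
  ∀ {w v P} → ExactPeriod s w P → InOrbit s w v → ExactPeriod s v P
ExactPeriod-InOrbit {s = s} s-inj {w} {P = P} (periodic , aperiodic) (m , refl) =
  trans (iterate-comm P m s w) (cong (iterate m s) periodic) ,
  λ j 0<j j<P sʲv≡v → aperiodic j 0<j j<P (iterate-injective s-inj m (trans (iterate-comm m j s w) sʲv≡v))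

-- Stronger than faceLabelling (each fibre of f is a single s-cycle), which makes it stable under
-- inserting an edge into a face.
record FaceLabelling (s : Fin N → Fin N) (f : Fin N → Fin n) (μ : Vec ℕ n) : Set where
  field
    degree-pos : ∀ x → 1 ≤ lookup μ (f x)
    invariant  : ∀ x → f (s x) ≡ f x
    connected  : ∀ x y → f x ≡ f y → InOrbit s x y
    exact      : ∀ x → ExactPeriod s x (lookup μ (f x))
    fibre      : ∀ i → countL (λ x → f x == i) (elems N) ≡ lookup μ i

  invariant-InOrbit : ∀ {x y} → InOrbit s x y → f y ≡ f x
  invariant-InOrbit (zero  , refl) = refl
  invariant-InOrbit (suc j , refl) = trans (invariant _) (invariant-InOrbit (j , refl))

module FaceInsertion {s : Fin N → Fin N} {f : Fin N → Fin n} {μ : Vec ℕ n}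
    (s-inj : Injective _≡_ _≡_ s) (faces : FaceLabelling s f μ) (y : Fin N) where

  open FaceLabelling faces

  c : Fin n
  c = f y
  s′ : Fin (suc N) → Fin (suc N)
  s′ = insertAfter y s
  f′ : Fin (suc N) → Fin n
  f′ = extend f c
  μ′ : Vec ℕ n
  μ′ = updateAt μ c suc

  f′-inject₁ : ∀ x → f′ (inject₁ x) ≡ f x
  f′-inject₁ = extend-inject₁ f c

  f′-fromℕ : f′ (fromℕ N) ≡ c
  f′-fromℕ = extend-fromℕ f c

  μ′-c : lookup μ′ c ≡ suc (lookup μ c)
  μ′-c = lookup∘updateAt c μ

  μ′-other : ∀ {i} → i ≢ c → lookup μ′ i ≡ lookup μ i
  μ′-other {i} i≢c = lookup∘updateAt′ i c i≢c μ

  private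
    P P′ : ℕ
    P = lookup μ c
    P′ = pred P
    suc-P′ : suc P′ ≡ P
    suc-P′ = suc-pred P {{>-nonZero (degree-pos y)}}

  avoids-y : ∀ i → i < P′ → iterate i s (s y) ≢ y
  avoids-y i i<P′ sⁱsy≡y = proj₂ (exact y) (suc i) (s≤s z≤n) (subst (suc i <_) suc-P′ (s≤s i<P′))
    (trans (iterate-suc i s y) sⁱsy≡y)

  iterate-from-new : ∀ t → t ≤ P′ → iterate (suc t) s′ (fromℕ N) ≡ inject₁ (iterate t s (s y))
  iterate-from-new t t≤P′ = trans (iterate-suc t s′ (fromℕ N)) (trans (cong (iterate t s′) (insertAfter-fromℕ y s))
    (iterate-insertAfter-avoiding y s t (s y) (λ i i<t → avoids-y i (≤-trans i<t t≤P′))))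

  exact-new : ExactPeriod s′ (fromℕ N) (suc P)
  exact-new = returns , stays-away
    where
    returns : iterate (suc P) s′ (fromℕ N) ≡ fromℕ N
    returns = begin
      iterate (suc P) s′ (fromℕ N)        ≡⟨ cong (λ k → iterate (suc k) s′ (fromℕ N)) suc-P′ ⟨
      s′ (iterate (suc P′) s′ (fromℕ N))  ≡⟨ cong s′ (iterate-from-new P′ ≤-refl) ⟩
      s′ (inject₁ (iterate P′ s (s y)))   ≡⟨ cong (s′ ∘ inject₁) (sym (iterate-suc P′ s y)) ⟩
      s′ (inject₁ (iterate (suc P′) s y)) ≡⟨ cong (λ k → s′ (inject₁ (iterate k s y))) suc-P′ ⟩
      s′ (inject₁ (iterate P s y))        ≡⟨ cong (s′ ∘ inject₁) (proj₁ (exact y)) ⟩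
      s′ (inject₁ y)                      ≡⟨ insertAfter-at y s ⟩
      fromℕ N                             ∎
      where open ≡-Reasoning
    stays-away : ∀ j → 0 < j → j < suc P → iterate j s′ (fromℕ N) ≢ fromℕ N
    stays-away (suc t) _ (s≤s t<P) eq =
      fromℕ≢inject₁ (trans (sym eq) (iterate-from-new t (s≤s⁻¹ (subst (suc t ≤_) (sym suc-P′) t<P))))

  InOrbit-new : ∀ x → f x ≡ c → InOrbit s′ (fromℕ N) (inject₁ x)
  InOrbit-new x fx≡c = InOrbit-trans (1 , insertAfter-fromℕ y s)
    (InOrbit-insertAfter⁺ y s (connected (s y) x (trans (invariant y) (sym fx≡c))))

  iterate-outside : ∀ x → f x ≢ c → ∀ t → iterate t s′ (inject₁ x) ≡ inject₁ (iterate t s x)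
  iterate-outside x fx≢c t = iterate-insertAfter-avoiding y s t x
    (λ i _ sⁱx≡y → fx≢c (trans (sym (invariant-InOrbit (i , refl))) (cong f sⁱx≡y)))

  exact′ : ∀ u → ExactPeriod s′ u (lookup μ′ (f′ u))
  exact′ u with lastView u
  ... | new = subst (ExactPeriod s′ (fromℕ N)) (sym (trans (cong (lookup μ′) f′-fromℕ) μ′-c)) exact-new
  ... | old x with f x ≟ c
  ...   | yes fx≡c = subst (ExactPeriod s′ (inject₁ x))
            (sym (trans (cong (lookup μ′) (trans (f′-inject₁ x) fx≡c)) μ′-c))
            (ExactPeriod-InOrbit (insertAfter-injective y s-inj) exact-new (InOrbit-new x fx≡c))
  ...   | no  fx≢c = subst (ExactPeriod s′ (inject₁ x)) (sym (trans (cong (lookup μ′) (f′-inject₁ x)) (μ′-other fx≢c)))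
            ( trans (iterate-outside x fx≢c (lookup μ (f x))) (cong inject₁ (proj₁ (exact x)))
            , λ j 0<j j<P sʲx≡x → proj₂ (exact x) j 0<j j<P (inject₁-injective (trans (sym (iterate-outside x fx≢c j)) sʲx≡x)))

  invariant′ : ∀ u → f′ (s′ u) ≡ f′ u
  invariant′ u with lastView u
  ... | new = trans (cong f′ (insertAfter-fromℕ y s)) (trans (f′-inject₁ (s y)) (trans (invariant y) (sym f′-fromℕ)))
  ... | old x with x ≟ y
  ...   | yes refl = trans (cong f′ (insertAfter-at x s)) (trans f′-fromℕ (sym (f′-inject₁ x)))
  ...   | no  x≢y  = trans (cong f′ (insertAfter-other y s x≢y)) (trans (f′-inject₁ (s x)) (trans (invariant x) (sym (f′-inject₁ x))))

  connected′ : ∀ u v → f′ u ≡ f′ v → InOrbit s′ u v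
  connected′ u v eq with lastView u | lastView v
  ... | new   | new   = 0 , refl
  ... | new   | old z = InOrbit-new z (trans (sym (f′-inject₁ z)) (trans (sym eq) f′-fromℕ))
  ... | old x | new   = InOrbit-trans (InOrbit-insertAfter⁺ y s (connected x y (trans (sym (f′-inject₁ x)) (trans eq f′-fromℕ))))
                                      (1 , insertAfter-at y s)
  ... | old x | old z = InOrbit-insertAfter⁺ y s (connected x z (trans (sym (f′-inject₁ x)) (trans eq (f′-inject₁ z))))

  fibre′ : ∀ i → countL (λ u → f′ u == i) (elems (suc N)) ≡ lookup μ′ i
  fibre′ i = begin
    countL (λ u → f′ u == i) (elems (suc N))
      ≡⟨ sumL-elems-last (λ u → iverson (f′ u == i) 1) ⟩
    countL (λ x → f′ (inject₁ x) == i) (elems N) + iverson (f′ (fromℕ N) == i) 1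
      ≡⟨ cong₂ (λ m b → m + iverson b 1) (trans (countL-cong (λ x → cong (_== i) (f′-inject₁ x)) (elems N)) (fibre i))
                                         (cong (_== i) f′-fromℕ) ⟩
    lookup μ i + iverson (c == i) 1
      ≡⟨ last-face ⟩
    lookup μ′ i
      ∎
    where
    open ≡-Reasoning
    last-face : lookup μ i + iverson (c == i) 1 ≡ lookup μ′ i
    last-face with i ≟ c
    ... | yes refl = trans (cong (λ b → lookup μ i + iverson b 1) (==-true {x = i} refl)) (trans (+-comm _ 1) (sym μ′-c))
    ... | no  i≢c  = trans (cong (λ b → lookup μ i + iverson b 1) (==-false (i≢c ∘ sym))) (trans (+-identityʳ _) (sym (μ′-other i≢c)))

  μ≤μ′ : ∀ i → lookup μ i ≤ lookup μ′ i
  μ≤μ′ i with i ≟ c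
  ... | yes refl = subst (lookup μ i ≤_) (sym μ′-c) (n≤1+n _)
  ... | no  i≢c  = ≤-reflexive (sym (μ′-other i≢c))

  degree-pos′ : ∀ u → 1 ≤ lookup μ′ (f′ u)
  degree-pos′ u with lastView u
  ... | new   = subst (λ i → 1 ≤ lookup μ′ i) (sym f′-fromℕ) (subst (1 ≤_) (sym μ′-c) (s≤s z≤n))
  ... | old x = subst (λ i → 1 ≤ lookup μ′ i) (sym (f′-inject₁ x)) (≤-trans (degree-pos x) (μ≤μ′ (f x)))

  faces′ : FaceLabelling s′ f′ μ′
  faces′ = record
    { degree-pos = degree-pos′ ; invariant = invariant′ ; connected = connected′ ; exact = exact′ ; fibre = fibre′ }

record OneBlackVertex (n N : ℕ) (μ : Vec ℕ n) (w : ℕ) : Set where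
  field
    σ₀ σ₁ σ₂   : Fin N → Fin N
    face       : Fin N → Fin n
    rep        : Fin n → Fin N
    σ₀-inj     : Injective _≡_ _≡_ σ₀
    σ₁-inj     : Injective _≡_ _≡_ σ₁
    σ₂-inj     : Injective _≡_ _≡_ σ₂
    product    : ∀ x → σ₀ (σ₁ (σ₂ x)) ≡ x
    black      : SingleOrbit σ₀
    white      : cycleCount σ₁ ≡ w
    faces      : FaceLabelling σ₂ face μ
    rep-face   : ∀ i → face (rep i) ≡ i

  σ₂-after-σ₀σ₁ : ∀ e → σ₂ (σ₀ (σ₁ e)) ≡ e
  σ₂-after-σ₀σ₁ e = σ₁-inj (σ₀-inj (product (σ₀ (σ₁ e))))

  σ₂⁻¹-unique : ∀ {x e} → σ₂ x ≡ e → x ≡ σ₀ (σ₁ e)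
  σ₂⁻¹-unique {x} refl = sym (product x)

  face-σ₀σ₁ : ∀ e → face (σ₀ (σ₁ e)) ≡ face e
  face-σ₀σ₁ e = trans (sym (FaceLabelling.invariant faces _)) (cong face (σ₂-after-σ₀σ₁ e))

-- A new white leaf hanging at the black vertex, placed in the face i.
leaf : ∀ {μ} (i : Fin n) → OneBlackVertex n N μ w → OneBlackVertex n (suc N) (updateAt μ i suc) (w + 1)
leaf {n} {N} {w} {μ} i D = record
  { σ₀ = insertAfter a σ₀ ; σ₁ = addFixedPoint σ₁ ; σ₂ = insertAfter y σ₂ ; face = f′ ; rep = inject₁ ∘ rep
  ; σ₀-inj = insertAfter-injective a σ₀-inj ; σ₁-inj = addFixedPoint-injective σ₁-inj
  ; σ₂-inj = insertAfter-injective y σ₂-inj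
  ; product = product′
  ; black = singleOrbit-insertAfter a σ₀ black
  ; white = trans (cycleCount-addFixedPoint σ₁ σ₁-inj) (cong (_+ 1) white)
  ; faces = subst (FaceLabelling (insertAfter y σ₂) f′) (cong (λ c → updateAt μ c suc) face-y) faces′
  ; rep-face = λ k → trans (f′-inject₁ (rep k)) (rep-face k) }
  where
  open OneBlackVertex D
  e a y : Fin N
  e = rep i
  a = σ₁ e
  y = σ₀ a
  open FaceInsertion σ₂-inj faces y using (f′; f′-inject₁; faces′)
  face-y : face y ≡ i
  face-y = trans (face-σ₀σ₁ e) (rep-face i)
  product′ : ∀ u → insertAfter a σ₀ (addFixedPoint σ₁ (insertAfter y σ₂ u)) ≡ u
  product′ u with lastView u
  ... | new = begin
    insertAfter a σ₀ (addFixedPoint σ₁ (insertAfter y σ₂ (fromℕ N))) ≡⟨ cong (insertAfter a σ₀ ∘ addFixedPoint σ₁) (insertAfter-fromℕ y σ₂) ⟩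
    insertAfter a σ₀ (addFixedPoint σ₁ (inject₁ (σ₂ y)))              ≡⟨ cong (insertAfter a σ₀) (addFixedPoint-inject₁ σ₁ _) ⟩
    insertAfter a σ₀ (inject₁ (σ₁ (σ₂ y)))                            ≡⟨ cong (insertAfter a σ₀ ∘ inject₁ ∘ σ₁) (σ₂-after-σ₀σ₁ e) ⟩
    insertAfter a σ₀ (inject₁ a)                                      ≡⟨ insertAfter-at a σ₀ ⟩
    fromℕ N                                                           ∎
    where open ≡-Reasoning
  ... | old x with x ≟ y
  ...   | yes refl = begin
    insertAfter a σ₀ (addFixedPoint σ₁ (insertAfter x σ₂ (inject₁ x))) ≡⟨ cong (insertAfter a σ₀ ∘ addFixedPoint σ₁) (insertAfter-at x σ₂) ⟩
    insertAfter a σ₀ (addFixedPoint σ₁ (fromℕ N))                       ≡⟨ cong (insertAfter a σ₀) (addFixedPoint-fromℕ σ₁) ⟩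
    insertAfter a σ₀ (fromℕ N)                                          ≡⟨ insertAfter-fromℕ a σ₀ ⟩
    inject₁ x                                                           ∎
    where open ≡-Reasoning
  ...   | no  x≢y  = begin
    insertAfter a σ₀ (addFixedPoint σ₁ (insertAfter y σ₂ (inject₁ x))) ≡⟨ cong (insertAfter a σ₀ ∘ addFixedPoint σ₁) (insertAfter-other y σ₂ x≢y) ⟩
    insertAfter a σ₀ (addFixedPoint σ₁ (inject₁ (σ₂ x)))                ≡⟨ cong (insertAfter a σ₀) (addFixedPoint-inject₁ σ₁ _) ⟩
    insertAfter a σ₀ (inject₁ (σ₁ (σ₂ x)))                              ≡⟨ insertAfter-other a σ₀ (x≢y ∘ σ₂⁻¹-unique ∘ σ₁-inj) ⟩
    inject₁ (σ₀ (σ₁ (σ₂ x)))                                            ≡⟨ cong inject₁ (product x) ⟩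
    inject₁ x                                                           ∎
    where open ≡-Reasoning

module _ (a : Fin N) (s : Fin N → Fin N) where

  private
    s″ : Fin (suc (suc N)) → Fin (suc (suc N))
    s″ = insertAfter (inject₁ a) (insertAfter a s)

  insertTwiceAfter-at : s″ (inject₁ (inject₁ a)) ≡ fromℕ (suc N)
  insertTwiceAfter-at = insertAfter-at (inject₁ a) (insertAfter a s)

  insertTwiceAfter-second : s″ (fromℕ (suc N)) ≡ inject₁ (fromℕ N)
  insertTwiceAfter-second = trans (insertAfter-fromℕ (inject₁ a) (insertAfter a s)) (cong inject₁ (insertAfter-at a s))

  insertTwiceAfter-first : s″ (inject₁ (fromℕ N)) ≡ inject₁ (inject₁ (s a))
  insertTwiceAfter-first = trans (insertAfter-other (inject₁ a) (insertAfter a s) fromℕ≢inject₁) (cong inject₁ (insertAfter-fromℕ a s))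

  insertTwiceAfter-other : ∀ {x} → x ≢ a → s″ (inject₁ (inject₁ x)) ≡ inject₁ (inject₁ (s x))
  insertTwiceAfter-other x≢a =
    trans (insertAfter-other (inject₁ a) (insertAfter a s) (x≢a ∘ inject₁-injective)) (cong inject₁ (insertAfter-other a s x≢a))

-- Two new edges p, q forming a handle: σ₀ gains a → q → p → σ₀ a, σ₁ gains e′ → q → p → σ₁ e′,
-- and the faces i and j (through y and y′) each gain one edge.
module Handle {μ : Vec ℕ n} (D : OneBlackVertex n N μ w) (i j : Fin n) where

  open OneBlackVertex D

  e e′ a y y′ : Fin N
  e = rep i
  e′ = rep j
  a = σ₁ e
  y = σ₀ a
  y′ = σ₀ (σ₁ e′)

  σ₀″ σ₁″ σ₂″ : Fin (suc (suc N)) → Fin (suc (suc N))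
  σ₀″ = insertAfter (inject₁ a) (insertAfter a σ₀)
  σ₁″ = insertAfter (inject₁ e′) (insertAfter e′ σ₁)
  σ₂′ : Fin (suc N) → Fin (suc N)
  σ₂′ = insertAfter y′ σ₂
  σ₂″ = insertAfter (inject₁ y) σ₂′

  module F₁ = FaceInsertion σ₂-inj faces y′
  module F₂ = FaceInsertion (insertAfter-injective y′ σ₂-inj) F₁.faces′ (inject₁ y)

  p q : Fin (suc (suc N))
  p = inject₁ (fromℕ N)
  q = fromℕ (suc N)

  e≡e′⇒y≡y′ : e ≡ e′ → y ≡ y′
  e≡e′⇒y≡y′ = cong (σ₀ ∘ σ₁)

  y≡y′⇒e≡e′ : y ≡ y′ → e ≡ e′
  y≡y′⇒e≡e′ y≡y′ = trans (sym (σ₂-after-σ₀σ₁ e)) (trans (cong σ₂ y≡y′) (σ₂-after-σ₀σ₁ e′))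

  open ≡-Reasoning

  product-q : σ₀″ (σ₁″ (σ₂″ q)) ≡ q
  product-q with y ≟ y′
  ... | yes y≡y′ = begin
    σ₀″ (σ₁″ (σ₂″ q))                       ≡⟨ cong (σ₀″ ∘ σ₁″) (insertAfter-fromℕ (inject₁ y) σ₂′) ⟩
    σ₀″ (σ₁″ (inject₁ (σ₂′ (inject₁ y))))   ≡⟨ cong (σ₀″ ∘ σ₁″ ∘ inject₁) (trans (cong (σ₂′ ∘ inject₁) y≡y′) (insertAfter-at y′ σ₂)) ⟩
    σ₀″ (σ₁″ p)                             ≡⟨ cong σ₀″ (insertTwiceAfter-first e′ σ₁) ⟩
    σ₀″ (inject₁ (inject₁ (σ₁ e′)))         ≡⟨ cong (σ₀″ ∘ inject₁ ∘ inject₁ ∘ σ₁) (y≡y′⇒e≡e′ y≡y′) ⟨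
    σ₀″ (inject₁ (inject₁ a))               ≡⟨ insertTwiceAfter-at a σ₀ ⟩
    q                                       ∎
  ... | no  y≢y′ = begin
    σ₀″ (σ₁″ (σ₂″ q))                       ≡⟨ cong (σ₀″ ∘ σ₁″) (insertAfter-fromℕ (inject₁ y) σ₂′) ⟩
    σ₀″ (σ₁″ (inject₁ (σ₂′ (inject₁ y))))   ≡⟨ cong (σ₀″ ∘ σ₁″ ∘ inject₁) (insertAfter-other y′ σ₂ y≢y′) ⟩
    σ₀″ (σ₁″ (inject₁ (inject₁ (σ₂ y))))    ≡⟨ cong (σ₀″ ∘ σ₁″ ∘ inject₁ ∘ inject₁) (σ₂-after-σ₀σ₁ e) ⟩
    σ₀″ (σ₁″ (inject₁ (inject₁ e)))         ≡⟨ cong σ₀″ (insertTwiceAfter-other e′ σ₁ (y≢y′ ∘ e≡e′⇒y≡y′)) ⟩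
    σ₀″ (inject₁ (inject₁ a))               ≡⟨ insertTwiceAfter-at a σ₀ ⟩
    q                                       ∎

  product-p : σ₀″ (σ₁″ (σ₂″ p)) ≡ p
  product-p = begin
    σ₀″ (σ₁″ (σ₂″ p))                       ≡⟨ cong (σ₀″ ∘ σ₁″) (insertAfter-other (inject₁ y) σ₂′ fromℕ≢inject₁) ⟩
    σ₀″ (σ₁″ (inject₁ (σ₂′ (fromℕ N))))     ≡⟨ cong (σ₀″ ∘ σ₁″ ∘ inject₁) (insertAfter-fromℕ y′ σ₂) ⟩
    σ₀″ (σ₁″ (inject₁ (inject₁ (σ₂ y′))))   ≡⟨ cong (σ₀″ ∘ σ₁″ ∘ inject₁ ∘ inject₁) (σ₂-after-σ₀σ₁ e′) ⟩
    σ₀″ (σ₁″ (inject₁ (inject₁ e′)))        ≡⟨ cong σ₀″ (insertTwiceAfter-at e′ σ₁) ⟩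
    σ₀″ q                                   ≡⟨ insertTwiceAfter-second a σ₀ ⟩
    p                                       ∎

  product-old : ∀ x → σ₀″ (σ₁″ (σ₂″ (inject₁ (inject₁ x)))) ≡ inject₁ (inject₁ x)
  product-old x with x ≟ y
  ... | yes refl = begin
    σ₀″ (σ₁″ (σ₂″ (inject₁ (inject₁ x))))   ≡⟨ cong (σ₀″ ∘ σ₁″) (insertAfter-at (inject₁ x) σ₂′) ⟩
    σ₀″ (σ₁″ q)                             ≡⟨ cong σ₀″ (insertTwiceAfter-second e′ σ₁) ⟩
    σ₀″ p                                   ≡⟨ insertTwiceAfter-first a σ₀ ⟩
    inject₁ (inject₁ x)                     ∎
  ... | no x≢y with x ≟ y′
  ...   | yes refl = begin
    σ₀″ (σ₁″ (σ₂″ (inject₁ (inject₁ x))))   ≡⟨ cong (σ₀″ ∘ σ₁″) (insertAfter-other (inject₁ y) σ₂′ (x≢y ∘ inject₁-injective)) ⟩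
    σ₀″ (σ₁″ (inject₁ (σ₂′ (inject₁ x))))   ≡⟨ cong (σ₀″ ∘ σ₁″ ∘ inject₁) (insertAfter-at x σ₂) ⟩
    σ₀″ (σ₁″ p)                             ≡⟨ cong σ₀″ (insertTwiceAfter-first e′ σ₁) ⟩
    σ₀″ (inject₁ (inject₁ (σ₁ e′)))         ≡⟨ insertTwiceAfter-other a σ₀ (x≢y ∘ sym ∘ e≡e′⇒y≡y′ ∘ σ₁-inj ∘ sym) ⟩
    inject₁ (inject₁ x)                     ∎
  ...   | no x≢y′ = begin
    σ₀″ (σ₁″ (σ₂″ (inject₁ (inject₁ x))))   ≡⟨ cong (σ₀″ ∘ σ₁″) (insertAfter-other (inject₁ y) σ₂′ (x≢y ∘ inject₁-injective)) ⟩
    σ₀″ (σ₁″ (inject₁ (σ₂′ (inject₁ x))))   ≡⟨ cong (σ₀″ ∘ σ₁″ ∘ inject₁) (insertAfter-other y′ σ₂ x≢y′) ⟩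
    σ₀″ (σ₁″ (inject₁ (inject₁ (σ₂ x))))    ≡⟨ cong σ₀″ (insertTwiceAfter-other e′ σ₁ (x≢y′ ∘ σ₂⁻¹-unique)) ⟩
    σ₀″ (inject₁ (inject₁ (σ₁ (σ₂ x))))     ≡⟨ insertTwiceAfter-other a σ₀ (x≢y ∘ σ₂⁻¹-unique ∘ σ₁-inj) ⟩
    inject₁ (inject₁ (σ₀ (σ₁ (σ₂ x))))      ≡⟨ cong (inject₁ ∘ inject₁) (product x) ⟩
    inject₁ (inject₁ x)                     ∎

  product″ : ∀ u → σ₀″ (σ₁″ (σ₂″ u)) ≡ u
  product″ u with lastView u
  ... | new = product-q
  ... | old u′ with lastView u′
  ...   | new   = product-p
  ...   | old x = product-old x

  handle : OneBlackVertex n (suc (suc N)) (updateAt (updateAt μ j suc) i suc) w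
  handle = record
    { σ₀ = σ₀″ ; σ₁ = σ₁″ ; σ₂ = σ₂″ ; face = F₂.f′ ; rep = inject₁ ∘ inject₁ ∘ rep
    ; σ₀-inj = insertAfter-injective (inject₁ a) (insertAfter-injective a σ₀-inj)
    ; σ₁-inj = insertAfter-injective (inject₁ e′) (insertAfter-injective e′ σ₁-inj)
    ; σ₂-inj = insertAfter-injective (inject₁ y) (insertAfter-injective y′ σ₂-inj)
    ; product = product″
    ; black = singleOrbit-insertAfter (inject₁ a) (insertAfter a σ₀) (singleOrbit-insertAfter a σ₀ black)
    ; white = trans (cycleCount-insertAfter (inject₁ e′) (insertAfter e′ σ₁) (insertAfter-injective e′ σ₁-inj))
                    (trans (cycleCount-insertAfter e′ σ₁ σ₁-inj) white)
    ; faces = subst (FaceLabelling σ₂″ F₂.f′) (cong₂ (λ c d → updateAt (updateAt μ d suc) c suc) face-y face-y′) F₂.faces′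
    ; rep-face = λ k → trans (F₂.f′-inject₁ _) (trans (F₁.f′-inject₁ (rep k)) (rep-face k)) }
    where
    face-y′ : face y′ ≡ j
    face-y′ = trans (face-σ₀σ₁ e′) (rep-face j)
    face-y : F₁.f′ (inject₁ y) ≡ i
    face-y = trans (F₁.f′-inject₁ y) (trans (face-σ₀σ₁ e) (rep-face i))

OneBlackVertex-cast : ∀ {N′ w′} {μ μ′ : Vec ℕ n} → N ≡ N′ → μ ≡ μ′ → w ≡ w′ →
  OneBlackVertex n N μ w → OneBlackVertex n N′ μ′ w′
OneBlackVertex-cast refl refl refl D = D

module Dipole (m : ℕ) where

  cyclicPred : Fin (suc m) → Fin (suc m)
  cyclicPred zero    = fromℕ m
  cyclicPred (suc x) = inject₁ x

  cyclicPred-injective : Injective _≡_ _≡_ cyclicPred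
  cyclicPred-injective {zero}  {zero}  _  = refl
  cyclicPred-injective {zero}  {suc y} eq = ⊥-elim (fromℕ≢inject₁ eq)
  cyclicPred-injective {suc x} {zero}  eq = ⊥-elim (fromℕ≢inject₁ (sym eq))
  cyclicPred-injective {suc x} {suc y} eq = cong suc (inject₁-injective eq)

  iterate-cyclicPred : ∀ k x y → toℕ y + k ≡ toℕ x → InOrbit cyclicPred x y
  iterate-cyclicPred zero    x       y eq = 0 , toℕ-injective (trans (sym eq) (+-identityʳ (toℕ y)))
  iterate-cyclicPred (suc k) zero    y eq = ⊥-elim (1+n≢0 (trans (sym (+-suc (toℕ y) k)) eq))
  iterate-cyclicPred (suc k) (suc x) y eq = InOrbit-trans (1 , refl)
    (iterate-cyclicPred k (inject₁ x) y (trans (suc-injective (trans (sym (+-suc (toℕ y) k)) eq)) (sym (toℕ-inject₁ x))))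

  singleOrbit-cyclicPred : SingleOrbit cyclicPred
  singleOrbit-cyclicPred x y = InOrbit-trans (iterate-cyclicPred (toℕ x) x zero refl)
    (InOrbit-trans (1 , refl) (iterate-cyclicPred (m ∸ toℕ y) (fromℕ m) y
      (trans (m+[n∸m]≡n (s≤s⁻¹ (toℕ<n y))) (sym (toℕ-fromℕ m)))))

  dipole-faces : FaceLabelling id id (replicate (suc m) 1)
  dipole-faces = record
    { degree-pos = λ x → ≤-reflexive (sym (lookup-replicate x 1))
    ; invariant  = λ _ → refl
    ; connected  = λ x y x≡y → 0 , x≡y
    ; exact      = λ x → subst (ExactPeriod id x) (sym (lookup-replicate x 1)) (refl , λ { (suc j) _ (s≤s ()) })
    ; fibre      = λ i → trans (occurs-once (enumerates-elems (suc m)) i) (sym (lookup-replicate i 1)) }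

  -- One black and one white vertex joined by m + 1 parallel edges; every face has degree 1.
  dipole : OneBlackVertex (suc m) (suc m) (replicate (suc m) 1) 1
  dipole = record
    { σ₀ = cyclicPred ; σ₁ = inverse cyclicPred ; σ₂ = id ; face = id ; rep = id
    ; σ₀-inj = cyclicPred-injective ; σ₁-inj = inverse-injective cyclicPred-injective ; σ₂-inj = id
    ; product = inverseʳ cyclicPred-injective
    ; black = singleOrbit-cyclicPred
    ; white = trans (cycleCount-inverse cyclicPred-injective) (cycleCount-singleOrbit (s≤s z≤n) cyclicPred-injective singleOrbit-cyclicPred)
    ; faces = dipole-faces
    ; rep-face = λ _ → refl }

n≤size : (μ : Vec ℕ n) → (∀ i → 1 ≤ lookup μ i) → n ≤ size μ
n≤size []      _   = z≤n
n≤size (x ∷ μ) μ≥1 = +-mono-≤ (μ≥1 zero) (n≤size μ (μ≥1 ∘ suc))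

size-updateAt-suc : (μ : Vec ℕ n) (i : Fin n) → size (updateAt μ i suc) ≡ suc (size μ)
size-updateAt-suc (x ∷ μ) zero    = refl
size-updateAt-suc (x ∷ μ) (suc i) = trans (cong (x +_) (size-updateAt-suc μ i)) (+-suc x (size μ))

all-ones : (μ : Vec ℕ n) → (∀ i → 1 ≤ lookup μ i) → size μ ≡ n → μ ≡ replicate n 1
all-ones []      _   _    = refl
all-ones (x ∷ μ) μ≥1 size≡ with μ≥1 zero | n≤size μ (μ≥1 ∘ suc)
... | s≤s {n = x′} _ | n≤sizeμ with x′
...   | zero  = cong (1 ∷_) (all-ones μ (μ≥1 ∘ suc) (suc-injective size≡))
...   | suc x″ = ⊥-elim (<⇒≱ (subst (size μ <_) (suc-injective size≡) (s≤s (m≤n+m (size μ) x″))) n≤sizeμ)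

∃-≥2 : ∀ {d} (μ : Vec ℕ n) → (∀ i → 1 ≤ lookup μ i) → size μ ≡ n + suc d → ∃[ i ] 2 ≤ lookup μ i
∃-≥2 {d = d} (x ∷ μ) μ≥1 size≡ with 2 ≤? x
... | yes 2≤x = zero , 2≤x
... | no  2≰x with refl ← ≤-antisym (s≤s⁻¹ (≰⇒> 2≰x)) (μ≥1 zero)
  with i , 2≤μᵢ ← ∃-≥2 μ (μ≥1 ∘ suc) (suc-injective size≡) = suc i , 2≤μᵢ

peel : ∀ {d} (μ : Vec ℕ n) → (∀ i → 1 ≤ lookup μ i) → size μ ≡ n + suc d →
  ∃[ i ] ∃[ μ′ ] updateAt μ′ i suc ≡ μ × (∀ k → 1 ≤ lookup μ′ k) × size μ′ ≡ n + d
peel {n} {d} μ μ≥1 size≡ with i , 2≤μᵢ ← ∃-≥2 μ μ≥1 size≡ = i , μ′ , restores , μ′≥1 , size-μ′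
  where
  μ′ : Vec ℕ n
  μ′ = updateAt μ i pred
  restores : updateAt μ′ i suc ≡ μ
  restores = trans (updateAt-updateAt-local i μ (suc-pred _ {{>-nonZero (≤-trans (s≤s z≤n) 2≤μᵢ)}})) (updateAt-id i μ)
  μ′≥1 : ∀ k → 1 ≤ lookup μ′ k
  μ′≥1 k with k ≟ i
  ... | yes refl = subst (1 ≤_) (sym (lookup∘updateAt k μ)) (pred-mono-≤ 2≤μᵢ)
  ... | no  k≢i  = subst (1 ≤_) (sym (lookup∘updateAt′ k i k≢i μ)) (μ≥1 k)
  size-μ′ : size μ′ ≡ n + d
  size-μ′ = suc-injective (trans (sym (size-updateAt-suc μ′ i)) (trans (cong size restores) (trans size≡ (+-suc n d))))

build : ∀ d g (μ : Vec ℕ n) → 1 ≤ n → (∀ i → 1 ≤ lookup μ i) → size μ ≡ n + d → 2 * g ≤ d →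
  OneBlackVertex n (n + d) μ (d + 1 ∸ 2 * g)
build {suc m} zero zero μ _ μ≥1 size≡ _ =
  OneBlackVertex-cast (sym (+-identityʳ (suc m))) (sym (all-ones μ μ≥1 (trans size≡ (+-identityʳ _)))) refl (Dipole.dipole m)
build {n} (suc d) zero μ n≥1 μ≥1 size≡ _ with i , μ′ , restores , μ′≥1 , size-μ′ ← peel μ μ≥1 size≡ =
  OneBlackVertex-cast (sym (+-suc n d)) restores (+-comm (d + 1) 1) (leaf i (build d zero μ′ n≥1 μ′≥1 size-μ′ z≤n))
build {n} d (suc g) μ n≥1 μ≥1 size≡ 2g+2≤d with subst (_≤ d) (*-suc 2 g) 2g+2≤d
... | s≤s (s≤s {n = d′} 2g≤d′)
  with i , μ′ , restores , μ′≥1 , size-μ′ ← peel μ μ≥1 size≡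
  with j , μ″ , restores′ , μ″≥1 , size-μ″ ← peel μ′ μ′≥1 size-μ′ =
  OneBlackVertex-cast (trans (cong suc (sym (+-suc n d′))) (sym (+-suc n (suc d′))))
    (trans (cong (λ ν → updateAt ν i suc) restores′) restores)
    (cong (suc (suc d′) + 1 ∸_) (sym (*-suc 2 g)))
    (Handle.handle (build d′ g μ″ n≥1 μ″≥1 size-μ″ 2g≤d′) i j)

-- The coefficients

module _ (s : Fin N → Fin N) where

  tabulate-injective : Injective _≡_ _≡_ s → Injective _≡_ _≡_ (app (tabulate s))
  tabulate-injective s-inj eq = s-inj (trans (sym (lookup∘tabulate s _)) (trans eq (lookup∘tabulate s _)))

  iter-tabulate : ∀ j x → iter j (tabulate s) x ≡ iterate j s x
  iter-tabulate j x = trans (iter≡iterate j (tabulate s) x) (iterate-cong (lookup∘tabulate s) j x)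

  cycles-tabulate : cycles (tabulate s) ≡ cycleCount s
  cycles-tabulate = trans (cycles≡cycleCount (tabulate s)) (cycleCount-cong (lookup∘tabulate s))

faceLabelling⁺ : ∀ {s : Fin N → Fin N} {f : Fin N → Fin n} {μ : Vec ℕ n} →
  FaceLabelling s f μ → T (faceLabelling μ (tabulate s) (tabulate f))
faceLabelling⁺ {N} {n} {s} {f} {μ} faces =
  T-∧-intro (allL-elems⁺ invariant′) (T-∧-intro (allL-elems⁺ fibre′) (allL-elems⁺ exact′))
  where
  open FaceLabelling faces
  f′ : Vec (Fin n) N
  f′ = tabulate f
  f′≗f : ∀ x → lookup f′ x ≡ f x
  f′≗f = lookup∘tabulate f
  invariant′ : ∀ x → T (lookup f′ (app (tabulate s) x) == lookup f′ x)
  invariant′ x = ≡⇒== (trans (f′≗f _) (trans (cong f (lookup∘tabulate s x)) (trans (invariant x) (sym (f′≗f x)))))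
  fibre′ : ∀ i → T (countL (λ x → lookup f′ x == i) (elems N) ≡ᵇ lookup μ i)
  fibre′ i = ≡⇒≡ᵇ _ _ (trans (countL-cong (λ x → cong (_== i) (f′≗f x)) (elems N)) (fibre i))
  exact′ : ∀ x → T ((iter (lookup μ (lookup f′ x)) (tabulate s) x == x)
    ∧ allL (λ j → (j ≡ᵇ 0) ∨ not (iter j (tabulate s) x == x)) (upTo (lookup μ (lookup f′ x))))
  exact′ x rewrite f′≗f x = T-∧-intro (≡⇒== (trans (iter-tabulate s (lookup μ (f x)) x) (proj₁ (exact x))))
    (allL-applyUpTo⁺ id _ not-back)
    where
    not-back : ∀ j → j < lookup μ (f x) → T ((j ≡ᵇ 0) ∨ not (iter j (tabulate s) x == x))
    not-back zero    _   = _
    not-back (suc j) j<P = Equivalence.from T-not-≡ (==-false (proj₂ (exact x) (suc j) (s≤s z≤n) j<P ∘ trans (sym (iter-tabulate s (suc j) x))))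

OneBlackVertex⇒IsDessin : ∀ {g n} {μ : Vec ℕ n} {w} (D : OneBlackVertex n (size μ) μ w) → 1 ≤ size μ →
  1 + w + n + 2 * g ≡ size μ + 2 → let open OneBlackVertex D in
  IsDessin g n μ 1 (tabulate σ₀) (tabulate σ₁) (tabulate σ₂) (tabulate face)
OneBlackVertex⇒IsDessin {g} {n} {μ} {w} D N≥1 euler = record
  { product   = productIsId⁺ (tabulate σ₀) (tabulate σ₁) (tabulate σ₂) λ x →
      trans (cong (app (tabulate σ₀) ∘ app (tabulate σ₁)) (lookup∘tabulate σ₂ x))
        (trans (cong (app (tabulate σ₀)) (lookup∘tabulate σ₁ _)) (trans (lookup∘tabulate σ₀ _) (product x)))
  ; connected = transitive-singleOrbit (tabulate σ₀) (tabulate σ₁) (tabulate-injective σ₀ σ₀-inj)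
      (λ x y → let j , σ₀ʲx≡y = black x y in j , trans (iterate-cong (lookup∘tabulate σ₀) j x) σ₀ʲx≡y)
  ; faces     = faceLabelling⁺ faces
  ; black     = b≡1
  ; euler     = trans (cong₂ (λ b w → b + w + n + 2 * g) b≡1 (trans (cycles-tabulate σ₁) white)) euler }
  where
  open OneBlackVertex D
  b≡1 : cycles (tabulate σ₀) ≡ 1
  b≡1 = trans (cycles-tabulate σ₀) (cycleCount-singleOrbit N≥1 σ₀-inj black)

IsDessin⇒dessinCount-pos : ∀ {g n} {μ : Vec ℕ n} {k} {σ₀ σ₁ σ₂ f} → IsDessin g n μ k σ₀ σ₁ σ₂ f →
  T (isPerm σ₀) → T (isPerm σ₁) → T (isPerm σ₂) → 1 ≤ dessinCount g n μ k
IsDessin⇒dessinCount-pos {g} {n} {μ} {k} {σ₀} {σ₁} {σ₂} {f} d p₀ p₁ p₂ = begin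
  1                                        ≡⟨ cong (λ b → iverson b 1) (sym (Equivalence.to T-≡ (isDessinᵇ⁺ d))) ⟩
  iverson (isDessinᵇ g n μ k σ₀ σ₁ σ₂ f) 1 ≤⟨ ≤-sumL (enumerates-allVecs (enumerates-elems n) (size μ)) (λ f → iverson (isDessinᵇ g n μ k σ₀ σ₁ σ₂ f) 1) f ⟩
  count σ₀ σ₁ σ₂                            ≤⟨ ≤-sumL-filterᵇ enum isPerm (count σ₀ σ₁) p₂ ⟩
  Σ (λ τ₂ → count σ₀ σ₁ τ₂)                 ≤⟨ ≤-sumL-filterᵇ enum isPerm (λ τ₁ → Σ (count σ₀ τ₁)) p₁ ⟩
  Σ (λ τ₁ → Σ (count σ₀ τ₁))                ≤⟨ ≤-sumL-filterᵇ enum isPerm (λ τ₀ → Σ (λ τ₁ → Σ (count τ₀ τ₁))) p₀ ⟩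
  Σ (λ τ₀ → Σ (λ τ₁ → Σ (count τ₀ τ₁)))     ≡⟨ dessinCount≡ g n μ k ⟨
  dessinCount g n μ k                      ∎
  where
  open ≤-Reasoning
  enum : Enumerates (≡-dec _≟_) (allVecs (elems (size μ)) (size μ))
  enum = enumerates-allVecs (enumerates-elems (size μ)) (size μ)
  count : Endo (size μ) → Endo (size μ) → Endo (size μ) → ℕ
  count τ₀ τ₁ τ₂ = countL (isDessinᵇ g n μ k τ₀ τ₁ τ₂) (allVecs (elems n) (size μ))
  Σ : (Endo (size μ) → ℕ) → ℕ
  Σ F = sumL (map F (perms (size μ)))

1≤cycles : 1 ≤ N → (σ : Endo N) → 1 ≤ cycles σ
1≤cycles N≥1 σ = subst (1 ≤_) (sym (cycles≡cycleCount σ)) (1≤cycleCount N≥1 (app σ))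

-- Euler's relation with at least one white vertex bounds the number of black vertices.
IsDessin-black-bounds : ∀ {g n} {μ : Vec ℕ n} {k σ₀ σ₁ σ₂ f} → 1 ≤ size μ → IsDessin g n μ k σ₀ σ₁ σ₂ f →
  1 ≤ k × k + (2 * g + n) ≤ size μ + 1
IsDessin-black-bounds {g} {n} {μ} {k} {σ₀} {σ₁} N≥1 d = subst (1 ≤_) black (1≤cycles N≥1 σ₀) , +-cancelʳ-≤ 1 _ _ (begin
  k + (2 * g + n) + 1                            ≤⟨ +-monoʳ-≤ (k + (2 * g + n)) (1≤cycles N≥1 σ₁) ⟩
  k + (2 * g + n) + cycles σ₁                    ≡⟨ cong (λ b → b + (2 * g + n) + cycles σ₁) black ⟨
  cycles σ₀ + (2 * g + n) + cycles σ₁            ≡⟨ rearrange (cycles σ₀) (cycles σ₁) n g ⟩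
  cycles σ₀ + cycles σ₁ + n + 2 * g              ≡⟨ euler ⟩
  size μ + 2                                     ≡⟨ +-assoc (size μ) 1 1 ⟨
  size μ + 1 + 1                                 ∎)
  where
  open IsDessin d
  open ≤-Reasoning
  rearrange : ∀ b w n g → b + (2 * g + n) + w ≡ b + w + n + 2 * g
  rearrange = solve-∀

dessinCount-vanishes : ∀ g n (μ : Vec ℕ n) k → (∀ {σ₀ σ₁ σ₂ f} → ¬ IsDessin g n μ k σ₀ σ₁ σ₂ f) → dessinCount g n μ k ≡ 0
dessinCount-vanishes g n μ k no-dessin = trans (dessinCount≡ g n μ k)
  (sumL-zero (λ σ₀ → sumL-zero (λ σ₁ → sumL-zero (λ σ₂ → sumL-zero (none σ₀ σ₁ σ₂) W) P) P) P)
  where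
  P : List (Endo (size μ))
  P = perms (size μ)
  W : List (Vec (Fin n) (size μ))
  W = allVecs (elems n) (size μ)
  none : ∀ σ₀ σ₁ σ₂ f → iverson (isDessinᵇ g n μ k σ₀ σ₁ σ₂ f) 1 ≡ 0
  none σ₀ σ₁ σ₂ f with isDessinᵇ g n μ k σ₀ σ₁ σ₂ f in eq
  ... | false = refl
  ... | true  = ⊥-elim (no-dessin (isDessinᵇ⁻ (subst T (sym eq) _)))

dessinCount-one-pos : ∀ g n (μ : Vec ℕ n) → 1 ≤ n → (∀ i → 1 ≤ lookup μ i) → 2 * g + n ≤ size μ → 1 ≤ dessinCount g n μ 1
dessinCount-one-pos g n μ n≥1 μ≥1 A≤N = IsDessin⇒dessinCount-pos
  (OneBlackVertex⇒IsDessin {g = g} D (≤-trans n≥1 n≤N) euler)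
  (isPerm⁺ (tabulate σ₀) (tabulate-injective σ₀ σ₀-inj)) (isPerm⁺ (tabulate σ₁) (tabulate-injective σ₁ σ₁-inj))
  (isPerm⁺ (tabulate σ₂) (tabulate-injective σ₂ σ₂-inj))
  where
  n≤N : n ≤ size μ
  n≤N = n≤size μ μ≥1
  d : ℕ
  d = size μ ∸ n
  2g≤d : 2 * g ≤ d
  2g≤d = m+n≤o⇒m≤o∸n (2 * g) A≤N
  D : OneBlackVertex n (size μ) μ (d + 1 ∸ 2 * g)
  D = OneBlackVertex-cast (m+[n∸m]≡n n≤N) refl refl (build d g μ n≥1 μ≥1 (sym (m+[n∸m]≡n n≤N)) 2g≤d)
  open OneBlackVertex D
  euler : 1 + (d + 1 ∸ 2 * g) + n + 2 * g ≡ size μ + 2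
  euler = begin
    1 + (d + 1 ∸ 2 * g) + n + 2 * g   ≡⟨ move-white (d + 1 ∸ 2 * g) n (2 * g) ⟩
    (d + 1 ∸ 2 * g) + 2 * g + n + 1   ≡⟨ cong (λ m → m + n + 1) (m∸n+n≡m (m≤n⇒m≤n+o 1 2g≤d)) ⟩
    d + 1 + n + 1                     ≡⟨ move-n d n ⟩
    n + d + 2                         ≡⟨ cong (_+ 2) (m+[n∸m]≡n n≤N) ⟩
    size μ + 2                        ∎
    where
    open ≡-Reasoning
    move-white : ∀ w n h → 1 + w + n + h ≡ w + h + n + 1
    move-white = solve-∀
    move-n : ∀ d n → d + 1 + n + 1 ≡ n + d + 2
    move-n = solve-∀

module _ (g n : ℕ) (μ : Vec ℕ n) where

  private
    over-N! : ℕ → ℚ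
    over-N! c = ℚ._/_ (ℤ.+ c) (size μ !) {{size μ !≢0}}

  Dcoeff-cong : ∀ k k′ → dessinCount g n μ k ≡ dessinCount g n μ k′ → Dcoeff g n μ k ≡ Dcoeff g n μ k′
  Dcoeff-cong k k′ = cong over-N!

  Dcoeff≡0 : ∀ k → dessinCount g n μ k ≡ 0 → Dcoeff g n μ k ≡ 0ℚ
  Dcoeff≡0 k count≡0 = trans (cong over-N! count≡0) (0/n≡0 (size μ !) {{size μ !≢0}})

  Dcoeff≢0 : ∀ k → 1 ≤ dessinCount g n μ k → Dcoeff g n μ k ≢ 0ℚ
  Dcoeff≢0 k count≥1 with dessinCount g n μ k | count≥1
  ... | suc c | _ = positive≢0 (normalize-pos (suc c) (size μ !) {{size μ !≢0}})
    where
    positive≢0 : ∀ {q} → Positive q → q ≢ 0ℚ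
    positive≢0 () refl

module _ (g n : ℕ) (μ : Vec ℕ n) (N≥1 : 1 ≤ size μ) where

  dessinCount-vanishes-below : size μ < 2 * g + n → ∀ k → dessinCount g n μ k ≡ 0
  dessinCount-vanishes-below N<A k = dessinCount-vanishes g n μ k λ d →
    let 1≤k , k+A≤N+1 = IsDessin-black-bounds N≥1 d in
    <⇒≱ N<A (s≤s⁻¹ (subst (suc (2 * g + n) ≤_) (+-comm (size μ) 1) (≤-trans (+-monoˡ-≤ (2 * g + n) 1≤k) k+A≤N+1)))

  dessinCount-vanishes-above : ∀ k → size μ + 1 ∸ (2 * g + n) < k → dessinCount g n μ k ≡ 0
  dessinCount-vanishes-above k top<k = dessinCount-vanishes g n μ k λ d →
    <⇒≱ top<k (m+n≤o⇒m≤o∸n k (proj₂ (IsDessin-black-bounds N≥1 d)))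

vertexCount≡suc-top : ∀ g n (μ : Vec ℕ n) → 2 * g + n ≤ size μ + 1 → vertexCount g n μ ≡ suc (size μ + 1 ∸ (2 * g + n))
vertexCount≡suc-top g n μ A≤N+1 = trans (cong (_∸ (2 * g + n)) (+-suc (size μ) 1)) (+-∸-assoc 1 A≤N+1)

dessinCount-top-pos : ∀ g n (μ : Vec ℕ n) → 1 ≤ n → (∀ i → 1 ≤ lookup μ i) → 2 * g + n ≤ size μ →
  1 ≤ dessinCount g n μ (size μ + 1 ∸ (2 * g + n))
dessinCount-top-pos g n μ n≥1 μ≥1 A≤N = begin
  1                                              ≤⟨ dessinCount-one-pos g n μ n≥1 μ≥1 A≤N ⟩
  dessinCount g n μ 1                            ≡⟨ dessinCount-symmetric g n μ 1 (subst (1 ≤_) (sym m≡suc-top) (s≤s z≤n)) ⟩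
  dessinCount g n μ (vertexCount g n μ ∸ 1)      ≡⟨ cong (λ m → dessinCount g n μ (m ∸ 1)) m≡suc-top ⟩
  dessinCount g n μ (size μ + 1 ∸ (2 * g + n))   ∎
  where
  open ≤-Reasoning
  m≡suc-top : vertexCount g n μ ≡ suc (size μ + 1 ∸ (2 * g + n))
  m≡suc-top = vertexCount≡suc-top g n μ (m≤n⇒m≤n+o 1 A≤N)

proposition4p7 : (g n : ℕ) → 1 ≤ n → (μ : Vec ℕ n) → ((i : Fin n) → 1 ≤ lookup μ i) →
    (size μ < 2 * g + n → (k : ℕ) → Dcoeff g n μ k ≡ 0ℚ)
    × (2 * g + n ≤ size μ →
        (Dcoeff g n μ (size μ + 1 ∸ (2 * g + n)) ≢ 0ℚ)
        × ((k : ℕ) → size μ + 1 ∸ (2 * g + n) < k → Dcoeff g n μ k ≡ 0ℚ)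
        × ∃ (λ (m : ℕ) → (k : ℕ) →
              (k ≤ m → Dcoeff g n μ k ≡ Dcoeff g n μ (m ∸ k))
              × (m < k → Dcoeff g n μ k ≡ 0ℚ)))
proposition4p7 g n n≥1 μ μ≥1 = below , λ A≤N →
  Dcoeff≢0 g n μ _ (dessinCount-top-pos g n μ n≥1 μ≥1 A≤N) , above ,
  (vertexCount g n μ , λ k → symmetric k , beyond A≤N k)
  where
  N≥1 : 1 ≤ size μ
  N≥1 = ≤-trans n≥1 (n≤size μ μ≥1)
  below : size μ < 2 * g + n → ∀ k → Dcoeff g n μ k ≡ 0ℚ
  below N<A k = Dcoeff≡0 g n μ k (dessinCount-vanishes-below g n μ N≥1 N<A k)
  above : ∀ k → size μ + 1 ∸ (2 * g + n) < k → Dcoeff g n μ k ≡ 0ℚ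
  above k top<k = Dcoeff≡0 g n μ k (dessinCount-vanishes-above g n μ N≥1 k top<k)
  symmetric : ∀ k → k ≤ vertexCount g n μ → Dcoeff g n μ k ≡ Dcoeff g n μ (vertexCount g n μ ∸ k)
  symmetric k k≤m = Dcoeff-cong g n μ k _ (dessinCount-symmetric g n μ k k≤m)
  beyond : 2 * g + n ≤ size μ → ∀ k → vertexCount g n μ < k → Dcoeff g n μ k ≡ 0ℚ
  beyond A≤N k m<k = above k (<⇒≤ (subst (_< k) (vertexCount≡suc-top g n μ (m≤n⇒m≤n+o 1 A≤N)) m<k))
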